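{- Let $G$ be a finite simple graph with edge weight function $w:E(G)\to\mathbb{C}\setminus\{0\}$ and vertex weight function $w_1:V(G)\to\mathbb{R}$. Then: (a) if $G$ is the disjoint union of graphs $G_1$ and $G_2$, then $\eta_{(w,w_1)}(G,x)=\eta_{(w,w_1)}(G_1,x)\eta_{(w,w_1)}(G_2,x)$; (b) if $e_{uv}\in E(G)$, then $\eta_{(w,w_1)}(G,x)=\eta_{(w,w_1)}(G-e_{uv},x)-|w(e_{uv})|^2\eta_{(w,w_1)}(G\setminus uv,x)$; (c) for every $u\in V(G)$, $\eta_{(w,w_1)}(G,x)=(x-w_1(u))\eta_{(w,w_1)}(G\setminus u,x)-\sum_{v\sim u}|w(e_{uv})|^2\eta_{(w,w_1)}(G\setminus uv,x)$, where the sum is over the neighbours $v$ of $u$; (d) $\frac{d}{dx}\eta_{(w,w_1)}(G,x)=\sum_{v\in V(G)}\eta_{(w,w_1)}(G\setminus v,x)$.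
   Context: $e_{uv}$ denotes the edge with endpoints $u,v$. $G\setminus uv$ deletes vertices $u,v$ and incident edges; $G-e$ deletes the edge $e$ only. Subgraphs inherit restricted weights. $H_G(S)$ is the subgraph induced by $S$. For a matching $M$ (including $\varnothing$), $w(M)=\prod_{e\in M}w(e)$, $w(\varnothing)=1$. For $H$ on $n$ vertices, $\mu_w(H,x)=\sum_{M}(-1)^{|M|}|w(M)|^2x^{n-2|M|}$, $\mu_w(\varnothing,x)=1$, and $\eta_{(w,w_1)}(H,x)=\sum_{S\subseteq V(H)}(-1)^{|V(H)\setminus S|}\big(\prod_{z\in V(H)\setminus S}w_1(z)\big)\mu_w(H_H(S),x)$, $\eta_{(w,w_1)}(\varnothing,x)=1$. -}

module Defs where

open import Level using (_⊔_)
open import Algebra.Bundles using (CommutativeRing)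
open import Data.Nat as ℕ using (ℕ; zero; suc; _∸_)
open import Data.Bool using (Bool; true; false; _∧_; _∨_; not; if_then_else_)
open import Data.Fin using (Fin; toℕ)
open import Data.List using (List; []; _∷_; _++_; map; foldr; length; filterᵇ; allFin; upTo; concatMap)
open import Data.Product using (_×_; _,_)
open import Relation.Binary.PropositionalEquality using (_≡_)
open import Relation.Nullary using (¬_)

eqF : ∀ {n} → Fin n → Fin n → Bool
eqF i j = toℕ i ℕ.≡ᵇ toℕ j

ltF : ∀ {n} → Fin n → Fin n → Bool
ltF i j = toℕ i ℕ.<ᵇ toℕ j

elemF : ∀ {n} → Fin n → List (Fin n) → Bool
elemF z []       = false
elemF z (y ∷ ys) = eqF z y ∨ elemF z ys

-- all sublists (= all subsets of a duplicate-free list)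
subs : ∀ {a} {A : Set a} → List A → List (List A)
subs []       = [] ∷ []
subs (x ∷ xs) = let r = subs xs in r ++ map (x ∷_) r

-- Graphs: (sub)graphs of the ambient vertex set Fin n, given by a vertex
-- membership test V and an adjacency test E.

record Graph (n : ℕ) : Set where
  constructor graph
  field
    V : Fin n → Bool
    E : Fin n → Fin n → Bool
open Graph public

IsSimple : ∀ {n} → Graph n → Set
IsSimple G = (∀ i j → E G i j ≡ E G j i)
           × (∀ i → E G i i ≡ false)
           × (∀ i j → E G i j ≡ true → V G i ≡ true)

verts : ∀ {n} → Graph n → List (Fin n)
verts {n} G = filterᵇ (V G) (allFin n)

edges : ∀ {n} → Graph n → List (Fin n × Fin n)
edges {n} G = concatMap (λ i → map (i ,_)
                 (filterᵇ (λ j → ltF i j ∧ V G i ∧ V G j ∧ E G i j) (allFin n)))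
              (allFin n)

disjointE : ∀ {n} → Fin n × Fin n → Fin n × Fin n → Bool
disjointE (a , b) (c , d) = not (eqF a c ∨ eqF a d ∨ eqF b c ∨ eqF b d)

allB : ∀ {a} {A : Set a} → (A → Bool) → List A → Bool
allB p []       = true
allB p (x ∷ xs) = p x ∧ allB p xs

isMatching : ∀ {n} → List (Fin n × Fin n) → Bool
isMatching []       = true
isMatching (e ∷ es) = allB (disjointE e) es ∧ isMatching es

matchings : ∀ {n} → Graph n → List (List (Fin n × Fin n))
matchings G = filterᵇ isMatching (subs (edges G))

induced : ∀ {n} → Graph n → (Fin n → Bool) → Graph n
induced G S = graph (λ z → V G z ∧ S z) (λ i j → E G i j ∧ S i ∧ S j)

delV : ∀ {n} → Graph n → Fin n → Graph n
delV G u = graph (λ z → V G z ∧ not (eqF z u))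
                 (λ i j → E G i j ∧ not (eqF i u) ∧ not (eqF j u))

delVV : ∀ {n} → Graph n → Fin n → Fin n → Graph n
delVV G u v = delV (delV G u) v

delE : ∀ {n} → Graph n → Fin n → Fin n → Graph n
delE G u v = graph (V G)
  (λ i j → E G i j ∧ not ((eqF i u ∧ eqF j v) ∨ (eqF i v ∧ eqF j u)))

-- union of two graphs (disjoint union when the vertex sets are disjoint)
union : ∀ {n} → Graph n → Graph n → Graph n
union G₁ G₂ = graph (λ z → V G₁ z ∨ V G₂ z) (λ i j → E G₁ i j ∨ E G₂ i j)

-- Everything numeric, over a commutative ring R playing the role of ℝ.

module WithRing {c ℓ} (R : CommutativeRing c ℓ) where
  open CommutativeRing R

  record Cx : Set c where
    constructor _+i_
    field re im : Carrier
  open Cx public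

  _≈C_ : Cx → Cx → Set ℓ
  z ≈C z' = (re z ≈ re z') × (im z ≈ im z')

  oneC : Cx
  oneC = 1# +i 0#

  mulC : Cx → Cx → Cx
  mulC (a +i b) (a' +i b') = (a * a' - b * b') +i (a * b' + b * a')

  normSq : Cx → Carrier
  normSq (a +i b) = a * a + b * b

  NonZeroC : Cx → Set ℓ
  NonZeroC z = ¬ ((re z ≈ 0#) × (im z ≈ 0#))

  sumR : List Carrier → Carrier
  sumR = foldr _+_ 0#

  prodR : List Carrier → Carrier
  prodR = foldr _*_ 1#

  sgn : ℕ → Carrier
  sgn zero    = 1#
  sgn (suc k) = - sgn k

  natMul : ℕ → Carrier → Carrier
  natMul zero    a = 0#
  natMul (suc k) a = a + natMul k a

  -- Polynomials in x over R, as coefficient sequences (coefficient of x^k)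

  Poly : Set c
  Poly = ℕ → Carrier

  _≋_ : Poly → Poly → Set ℓ
  p ≋ q = ∀ k → p k ≈ q k

  zeroP : Poly
  zeroP _ = 0#

  constP : Carrier → Poly
  constP a zero    = a
  constP a (suc _) = 0#

  X : Poly
  X k = if k ℕ.≡ᵇ 1 then 1# else 0#

  xpow : ℕ → Poly
  xpow m k = if k ℕ.≡ᵇ m then 1# else 0#

  _⊕_ : Poly → Poly → Poly
  (p ⊕ q) k = p k + q k

  _⊖_ : Poly → Poly → Poly
  (p ⊖ q) k = p k - q k

  _⊛_ : Carrier → Poly → Poly
  (a ⊛ p) k = a * p k

  _⊗_ : Poly → Poly → Poly
  (p ⊗ q) k = sumR (map (λ i → p i * q (k ∸ i)) (upTo (suc k)))

  D : Poly → Poly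
  D p k = natMul (suc k) (p (suc k))

  polySum : List Poly → Poly
  polySum = foldr _⊕_ zeroP

  wM : ∀ {n} → (Fin n → Fin n → Cx) → List (Fin n × Fin n) → Cx
  wM w []            = oneC
  wM w ((i , j) ∷ M) = mulC (w i j) (wM w M)

  -- w is an admissible edge weight on G: symmetric (a function of the
  -- unordered edge) and nonzero on every edge
  EdgeWeight : ∀ {n} → Graph n → (Fin n → Fin n → Cx) → Set ℓ
  EdgeWeight G w = (∀ u v → E G u v ≡ true → w u v ≈C w v u)
                 × (∀ u v → E G u v ≡ true → NonZeroC (w u v))

  μ : ∀ {n} → (Fin n → Fin n → Cx) → Graph n → Poly
  μ w H = polySum (map (λ M → (sgn (length M) * normSq (wM w M))
                               ⊛ xpow (length (verts H) ∸ 2 ℕ.* length M))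
                       (matchings H))

  η : ∀ {n} → (Fin n → Fin n → Cx) → (Fin n → Carrier) → Graph n → Poly
  η w w₁ H = polySum (map term (subs (verts H)))
    where
    term : List _ → Poly
    term S = let comp = filterᵇ (λ z → not (elemF z S)) (verts H)
             in (sgn (length comp) * prodR (map w₁ comp))
                  ⊛ μ w (induced H (λ z → elemF z S))

-- Everything rests on the vertex recurrence (c). For the matching polynomial it comes
-- from sorting the matchings of H by the edge covering u, if any: those avoiding u are
-- the matchings of H∖u, which has one vertex fewer (a factor x), and those through uv
-- are the matchings of H∖uv plus one edge (a factor −|w(uv)|²). In the sum over the
-- vertex sets S defining η, the sets without u put u into the complement (a factor
-- −w₁(u)), while for the sets containing u the recurrence for μ gives
-- x η(G∖u) − Σ_v |w(uv)|² η(G∖uv). Part (b) compares (c) for G and for G − e_uv, whose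
-- expansions at u differ only in the neighbour v; (a) and (d) follow by induction on
-- the number of vertices, expanding at a vertex u with (c).

module Submission where

open import Defs
open import Level using (_⊔_)
open import Algebra.Bundles using (CommutativeRing)
open import Data.Bool using (Bool; true; false; _∧_; _∨_; not; _xor_; if_then_else_; T)
open import Data.Bool.Properties using (T?; T-∧; ∧-conicalˡ; ∧-conicalʳ; ∧-zeroʳ; ∧-identityʳ; ∨-zeroʳ; ∨-identityʳ)
open import Data.Empty using (⊥-elim)
open import Data.Fin as Fin using (Fin; toℕ)
import Data.Fin.Properties as Finₚ
open import Data.List using (List; []; _∷_; _++_; map; length; filterᵇ; allFin; concatMap; applyUpTo)
import Data.List.Properties as Listₚ
open import Data.List.Relation.Unary.All as All using (All; []; _∷_)
import Data.List.Relation.Unary.All.Properties as Allₚ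
open import Data.List.Relation.Binary.Permutation.Propositional using (_↭_; prep; swap; ↭-sym; ↭-reflexive)
import Data.List.Relation.Binary.Permutation.Propositional as Perm
import Data.List.Relation.Binary.Permutation.Propositional.Properties as Permₚ
open import Data.Nat as ℕ using (ℕ; zero; suc; _≤_; _<_; z≤n; s≤s; _∸_)
import Data.Nat.Properties as ℕₚ
open import Data.Nat.Induction using (<-rec)
open import Data.Product using (∃; _×_; _,_; proj₁; proj₂)
open import Data.Sum using (_⊎_; inj₁; inj₂)
open import Function using (_∘_; Equivalence)
open import Relation.Binary.Definitions using (tri<; tri≈; tri>)
open import Relation.Binary.PropositionalEquality
  using (_≡_; _≢_; refl; sym; trans; cong; cong₂; subst)
open import Data.Maybe using (nothing)
open import Tactic.RingSolver.Core.AlmostCommutativeRing using (fromCommutativeRing)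
import Tactic.RingSolver.NonReflective as NonReflective
import Algebra.Properties.Ring as RingProperties
open import Relation.Binary.Bundles using (Setoid)
import Relation.Binary.Reasoning.Setoid as SetoidReasoning

BoolFun : ℕ → Set
BoolFun zero    = Bool
BoolFun (suc k) = Bool → BoolFun k

agree : ∀ k → BoolFun k → BoolFun k → Bool
agree zero    f g = not (f xor g)
agree (suc k) f g = agree k (f true) (g true) ∧ agree k (f false) (g false)

Pointwise : ∀ k → BoolFun k → BoolFun k → Set
Pointwise zero    f g = f ≡ g
Pointwise (suc k) f g = ∀ b → Pointwise k (f b) (g b)

-- Boolean identities in k variables, checked on all 2^k rows; f and g are
-- found by pattern unification from the stated identity.
truth-table : ∀ k {f g : BoolFun k} → T (agree k f g) → Pointwise k f g
truth-table zero    {true}  {true}  _ = refl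
truth-table zero    {false} {false} _ = refl
truth-table (suc k) h true  = truth-table k (proj₁ (Equivalence.to T-∧ h))
truth-table (suc k) h false = truth-table k (proj₂ (Equivalence.to T-∧ h))

true-or-false : ∀ b → b ≡ true ⊎ b ≡ false
true-or-false true  = inj₁ refl
true-or-false false = inj₂ refl

true≢false : true ≢ false
true≢false ()

not-true⇒false : ∀ {a} → not a ≡ true → a ≡ false
not-true⇒false {false} _ = refl

∨-leftComm : ∀ a b c → a ∨ (b ∨ c) ≡ b ∨ (a ∨ c)
∨-leftComm = truth-table 3 _

∧-leftComm : ∀ a b c → a ∧ (b ∧ c) ≡ b ∧ (a ∧ c)
∧-leftComm = truth-table 3 _

T⇒≡true : ∀ {b} → T b → b ≡ true
T⇒≡true {true} _ = refl

eqF-refl : ∀ {n} (i : Fin n) → eqF i i ≡ true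
eqF-refl i = T⇒≡true (ℕₚ.≡⇒≡ᵇ (toℕ i) (toℕ i) refl)

eqF⇒≡ : ∀ {n} {i j : Fin n} → eqF i j ≡ true → i ≡ j
eqF⇒≡ {i = i} {j} e = Finₚ.toℕ-injective (ℕₚ.≡ᵇ⇒≡ (toℕ i) (toℕ j) (subst T (sym e) _))

≢⇒eqF≡false : ∀ {n} {i j : Fin n} → i ≢ j → eqF i j ≡ false
≢⇒eqF≡false {i = i} {j} i≢j with eqF i j in e
... | true  = ⊥-elim (i≢j (eqF⇒≡ e))
... | false = refl

eqF-sym : ∀ {n} (i j : Fin n) → eqF i j ≡ eqF j i
eqF-sym i j with eqF i j in e
... | true with refl ← eqF⇒≡ {i = i} {j} e = sym (eqF-refl j)
... | false = sym (≢⇒eqF≡false {i = j} {i} λ { refl → true≢false (trans (sym (eqF-refl i)) e) })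

ltF-irrefl : ∀ {n} (i : Fin n) → ltF i i ≡ false
ltF-irrefl i with ltF i i in e
... | true  = ⊥-elim (ℕₚ.<-irrefl refl (ℕₚ.<ᵇ⇒< (toℕ i) (toℕ i) (subst T (sym e) _)))
... | false = refl

ltF-asym : ∀ {n} {i j : Fin n} → ltF i j ≡ true → ltF j i ≡ false
ltF-asym {i = i} {j} e with ltF j i in e′
... | true  = ⊥-elim (ℕₚ.<-asym (ℕₚ.<ᵇ⇒< (toℕ i) (toℕ j) (subst T (sym e) _))
                                (ℕₚ.<ᵇ⇒< (toℕ j) (toℕ i) (subst T (sym e′) _)))
... | false = refl

ltF-connex : ∀ {n} {i j : Fin n} → eqF i j ≡ false → ltF i j ≡ false → ltF j i ≡ true
ltF-connex {i = i} {j} e l with ℕₚ.<-cmp (toℕ i) (toℕ j)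
... | tri< i<j _ _ = ⊥-elim (true≢false (trans (sym (T⇒≡true (ℕₚ.<⇒<ᵇ i<j))) l))
... | tri≈ _ i≡j _ with refl ← Finₚ.toℕ-injective i≡j = ⊥-elim (true≢false (trans (sym (eqF-refl i)) e))
... | tri> _ _ j<i = T⇒≡true (ℕₚ.<⇒<ᵇ j<i)

ltF⇒eqF≡false : ∀ {n} {i j : Fin n} → ltF i j ≡ true → eqF i j ≡ false
ltF⇒eqF≡false {i = i} {j} e = ≢⇒eqF≡false {i = i} {j} λ { refl → true≢false (trans (sym e) (ltF-irrefl i)) }

module _ {a} {A : Set a} where

  filter-cong : ∀ {p q : A → Bool} (L : List A) → (∀ x → p x ≡ q x) → filterᵇ p L ≡ filterᵇ q L
  filter-cong []       _ = refl
  filter-cong {p} {q} (x ∷ L) p≗q with p x | q x | p≗q x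
  ... | true  | true  | _ = cong (x ∷_) (filter-cong L p≗q)
  ... | false | false | _ = filter-cong L p≗q

  filter-filter : ∀ (p q : A → Bool) L → filterᵇ q (filterᵇ p L) ≡ filterᵇ (λ x → p x ∧ q x) L
  filter-filter p q [] = refl
  filter-filter p q (x ∷ L) with p x
  ... | false = filter-filter p q L
  ... | true with q x
  ...   | true  = cong (x ∷_) (filter-filter p q L)
  ...   | false = filter-filter p q L

  filter-false : ∀ (p : A → Bool) L → All (λ x → p x ≡ false) L → filterᵇ p L ≡ []
  filter-false p [] _ = refl
  filter-false p (x ∷ L) (px ∷ pL) rewrite px = filter-false p L pL

  All-filter : ∀ {ℓ} {P : A → Set ℓ} (p : A → Bool) L → (∀ x → p x ≡ true → P x) → All P (filterᵇ p L)
  All-filter p [] _ = []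
  All-filter p (x ∷ L) h with p x in e
  ... | true  = h x e ∷ All-filter p L h
  ... | false = All-filter p L h

  filter-partition : ∀ (p : A → Bool) L → L ↭ filterᵇ p L ++ filterᵇ (not ∘ p) L
  filter-partition p [] = Perm.refl
  filter-partition p (x ∷ L) with p x
  ... | true  = prep x (filter-partition p L)
  ... | false = Perm.trans (prep x (filter-partition p L)) (↭-sym (Permₚ.shift x (filterᵇ p L) _))

  length-filter-mono : ∀ (p q : A → Bool) L → (∀ x → p x ≡ true → q x ≡ true) →
                       length (filterᵇ p L) ≤ length (filterᵇ q L)
  length-filter-mono p q [] h = z≤n
  length-filter-mono p q (x ∷ L) h with p x in e₁ | q x in e₂
  ... | true  | true  = s≤s (length-filter-mono p q L h)
  ... | false | true  = ℕₚ.m≤n⇒m≤1+n (length-filter-mono p q L h)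
  ... | false | false = length-filter-mono p q L h
  ... | true  | false = ⊥-elim (true≢false (trans (sym (h x e₁)) e₂))

  All-subs : ∀ {ℓ} {P : A → Set ℓ} (L : List A) → All P L → All (All P) (subs L)
  All-subs []      _          = [] ∷ []
  All-subs (x ∷ L) (px ∷ pL) = Allₚ.++⁺ (All-subs L pL) (Allₚ.map⁺ (All.map (px ∷_) (All-subs L pL)))

filter-map : ∀ {a b} {A : Set a} {B : Set b} (f : B → A) (p : A → Bool) L →
             filterᵇ p (map f L) ≡ map f (filterᵇ (p ∘ f) L)
filter-map f p [] = refl
filter-map f p (x ∷ L) with p (f x)
... | true  = cong (f x ∷_) (filter-map f p L)
... | false = filter-map f p L

filter-eqF-allFin : ∀ {n} (u : Fin n) → filterᵇ (λ z → eqF z u) (allFin n) ≡ u ∷ []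
filter-eqF-allFin {suc n} u = trans (cong (filterᵇ (λ z → eqF z u)) allFin-suc) (case u)
  where
  allFin-suc : allFin (suc n) ≡ Fin.zero ∷ map Fin.suc (allFin n)
  allFin-suc = cong (Fin.zero ∷_) (sym (Listₚ.map-tabulate (λ x → x) Fin.suc))
  case : ∀ u → filterᵇ (λ z → eqF z u) (Fin.zero ∷ map Fin.suc (allFin n)) ≡ u ∷ []
  case Fin.zero    = cong (Fin.zero ∷_) (trans (filter-map Fin.suc _ (allFin n))
                       (cong (map Fin.suc) (filter-false _ (allFin n) (All.tabulate (λ _ → refl)))))
  case (Fin.suc u) = trans (filter-map Fin.suc _ (allFin n)) (cong (map Fin.suc) (filter-eqF-allFin u))

filter-allFin-remove : ∀ {n} (P : Fin n → Bool) (u : Fin n) → P u ≡ true →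
  filterᵇ P (allFin n) ↭ u ∷ filterᵇ (λ z → P z ∧ not (eqF z u)) (allFin n)
filter-allFin-remove {n} P u Pu = Perm.trans (filter-partition (λ z → eqF z u) (filterᵇ P (allFin n)))
  (↭-reflexive (cong₂ _++_ only-u (filter-filter P _ (allFin n))))
  where
  P∧eqF : ∀ z → (P z ∧ eqF z u) ≡ eqF z u
  P∧eqF z with eqF z u in e
  ... | true with refl ← eqF⇒≡ {i = z} {u} e rewrite Pu = refl
  ... | false = ∧-zeroʳ (P z)
  only-u : filterᵇ (λ z → eqF z u) (filterᵇ P (allFin n)) ≡ u ∷ []
  only-u = trans (filter-filter P _ (allFin n)) (trans (filter-cong (allFin n) P∧eqF) (filter-eqF-allFin u))

count : ∀ {n} → (Fin n → Bool) → ℕ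
count {n} P = length (filterᵇ P (allFin n))

count-remove : ∀ {n} (P : Fin n → Bool) (u : Fin n) → P u ≡ true →
               count P ≡ suc (count (λ z → P z ∧ not (eqF z u)))
count-remove P u Pu = Permₚ.↭-length (filter-allFin-remove P u Pu)

elemF-↭ : ∀ {n} (z : Fin n) {S S′} → S ↭ S′ → elemF z S ≡ elemF z S′
elemF-↭ z Perm.refl      = refl
elemF-↭ z (prep x p)     = cong (eqF z x ∨_) (elemF-↭ z p)
elemF-↭ z (swap x y p)   = trans (cong (λ b → eqF z x ∨ eqF z y ∨ b) (elemF-↭ z p))
                                 (∨-leftComm (eqF z x) (eqF z y) _)
elemF-↭ z (Perm.trans p q) = trans (elemF-↭ z p) (elemF-↭ z q)

elemF-∉ : ∀ {n} (z : Fin n) S → All (λ y → eqF y z ≡ false) S → elemF z S ≡ false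
elemF-∉ z []      _          = refl
elemF-∉ z (y ∷ S) (y≢z ∷ h) rewrite eqF-sym z y | y≢z = elemF-∉ z S h

allB-↭ : ∀ {a} {A : Set a} (p : A → Bool) {S S′} → S ↭ S′ → allB p S ≡ allB p S′
allB-↭ p Perm.refl        = refl
allB-↭ p (prep x q)       = cong (p x ∧_) (allB-↭ p q)
allB-↭ p (swap x y q)     = trans (cong (λ b → p x ∧ p y ∧ b) (allB-↭ p q)) (∧-leftComm (p x) (p y) _)
allB-↭ p (Perm.trans q r) = trans (allB-↭ p q) (allB-↭ p r)

disjointE-sym : ∀ {n} (e f : Fin n × Fin n) → disjointE e f ≡ disjointE f e
disjointE-sym (a , b) (c , d)
  rewrite eqF-sym c a | eqF-sym c b | eqF-sym d a | eqF-sym d b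
  = swap-middle (eqF a c) (eqF a d) (eqF b c) (eqF b d)
  where
  swap-middle : ∀ x y z t → not (x ∨ y ∨ z ∨ t) ≡ not (x ∨ z ∨ y ∨ t)
  swap-middle = truth-table 4 _

isMatching-↭ : ∀ {n} {S S′ : List (Fin n × Fin n)} → S ↭ S′ → isMatching S ≡ isMatching S′
isMatching-↭ Perm.refl = refl
isMatching-↭ (prep x p) = cong₂ _∧_ (allB-↭ (disjointE x) p) (isMatching-↭ p)
isMatching-↭ (swap {ys = ys} x y p)
  rewrite allB-↭ (disjointE x) p | allB-↭ (disjointE y) p | isMatching-↭ p | disjointE-sym x y
  = interchange (disjointE y x) (allB (disjointE x) ys) (allB (disjointE y) ys) (isMatching ys)
  where
  interchange : ∀ a b c d → (a ∧ b) ∧ (c ∧ d) ≡ (a ∧ c) ∧ (b ∧ d)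
  interchange = truth-table 4 _
isMatching-↭ (Perm.trans p q) = trans (isMatching-↭ p) (isMatching-↭ q)

disjointE⇒distinct : ∀ {n} {a b c d : Fin n} → disjointE (a , b) (c , d) ≡ true →
  eqF a c ≡ false × eqF a d ≡ false × eqF b c ≡ false × eqF b d ≡ false
disjointE⇒distinct {a = a} {b} {c} {d} = not-∨⁴ (eqF a c) (eqF a d) (eqF b c) (eqF b d)
  where
  not-∨⁴ : ∀ x y z t → not (x ∨ y ∨ z ∨ t) ≡ true → x ≡ false × y ≡ false × z ≡ false × t ≡ false
  not-∨⁴ false false false false _ = refl , refl , refl , refl
  not-∨⁴ true  _     _     _     ()
  not-∨⁴ false true  _     _     ()
  not-∨⁴ false false true  _     ()
  not-∨⁴ false false false true  ()

touches : ∀ {n} → Fin n → Fin n × Fin n → Bool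
touches u (i , j) = eqF i u ∨ eqF j u

touches⇒ : ∀ {n} (u : Fin n) {a b} → touches u (a , b) ≡ true → a ≡ u ⊎ b ≡ u
touches⇒ u {a} {b} t with eqF a u in e
... | true  = inj₁ (eqF⇒≡ {i = a} {u} e)
... | false = inj₂ (eqF⇒≡ {i = b} {u} t)

touches-disjointE : ∀ {n} (u : Fin n) e f → touches u e ≡ true → touches u f ≡ true → disjointE e f ≡ false
touches-disjointE u (a , b) (c , d) te tf with disjointE (a , b) (c , d) in dj
... | false = refl
... | true with disjointE⇒distinct {a = a} {b} {c} {d} dj | touches⇒ u {a} {b} te | touches⇒ u {c} {d} tf
...   | ac , _  , _  , _  | inj₁ refl | inj₁ refl = trans (sym (eqF-refl u)) ac
...   | _  , ad , _  , _  | inj₁ refl | inj₂ refl = trans (sym (eqF-refl u)) ad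
...   | _  , _  , bc , _  | inj₂ refl | inj₁ refl = trans (sym (eqF-refl u)) bc
...   | _  , _  , _  , bd | inj₂ refl | inj₂ refl = trans (sym (eqF-refl u)) bd

_≅_ : ∀ {n} → Graph n → Graph n → Set
G ≅ H = (∀ z → V G z ≡ V H z) × (∀ i j → V G i ≡ true → V G j ≡ true → E G i j ≡ E H i j)

≅-sym : ∀ {n} {G H : Graph n} → G ≅ H → H ≅ G
≅-sym (v , e) = (λ z → sym (v z)) , (λ i j vi vj → sym (e i j (trans (v i) vi) (trans (v j) vj)))

≅-trans : ∀ {n} {G H K : Graph n} → G ≅ H → H ≅ K → G ≅ K
≅-trans (v₁ , e₁) (v₂ , e₂) = (λ z → trans (v₁ z) (v₂ z)) ,
  (λ i j vi vj → trans (e₁ i j vi vj) (e₂ i j (trans (sym (v₁ i)) vi) (trans (sym (v₁ j)) vj)))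

verts-≅ : ∀ {n} {G H : Graph n} → G ≅ H → verts G ≡ verts H
verts-≅ {n} (v , _) = filter-cong (allFin n) v

isEdge : ∀ {n} → Graph n → Fin n × Fin n → Bool
isEdge G (i , j) = ltF i j ∧ V G i ∧ V G j ∧ E G i j

allPairs : ∀ n → List (Fin n × Fin n)
allPairs n = concatMap (λ i → map (i ,_) (allFin n)) (allFin n)

edges≡filter-allPairs : ∀ {n} (G : Graph n) → edges G ≡ filterᵇ (isEdge G) (allPairs n)
edges≡filter-allPairs {n} G = go (allFin n)
  where
  go : ∀ L → concatMap (λ i → map (i ,_) (filterᵇ (λ j → isEdge G (i , j)) (allFin n))) L
           ≡ filterᵇ (isEdge G) (concatMap (λ i → map (i ,_) (allFin n)) L)
  go []      = refl
  go (i ∷ L) = sym (trans (Listₚ.filter-++ (T? ∘ isEdge G) (map (i ,_) (allFin n)) _)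
                          (cong₂ _++_ (filter-map (i ,_) (isEdge G) (allFin n)) (sym (go L))))

edges-≅ : ∀ {n} {G H : Graph n} → G ≅ H → edges G ≡ edges H
edges-≅ {n} {G} {H} (v , e) = trans (edges≡filter-allPairs G)
  (trans (filter-cong (allPairs n) isEdge-≅) (sym (edges≡filter-allPairs H)))
  where
  isEdge-≅ : ∀ p → isEdge G p ≡ isEdge H p
  isEdge-≅ (i , j) with V G i in vi | V G j in vj
  ... | true  | true  rewrite sym (v i) | sym (v j) | vi | vj | e i j vi vj = refl
  ... | true  | false rewrite sym (v i) | sym (v j) | vi | vj = refl
  ... | false | _     rewrite sym (v i) | vi = refl

induced-≅ : ∀ {n} {G H : Graph n} (P : Fin n → Bool) → G ≅ H → induced G P ≅ induced H P
induced-≅ P (v , e) = (λ z → cong (_∧ P z) (v z)) ,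
  (λ i j vi vj → cong (_∧ _) (e i j (∧-conicalˡ _ _ vi) (∧-conicalˡ _ _ vj)))

delV-≅ : ∀ {n} {G H : Graph n} (u : Fin n) → G ≅ H → delV G u ≅ delV H u
delV-≅ u (v , e) = (λ z → cong (_∧ _) (v z)) ,
  (λ i j vi vj → cong (_∧ _) (e i j (∧-conicalˡ _ _ vi) (∧-conicalˡ _ _ vj)))

vertex≢absent : ∀ {n} (G : Graph n) {i u} → V G i ≡ true → V G u ≡ false → eqF i u ≡ false
vertex≢absent G {i} {u} Vi Vu = ≢⇒eqF≡false {i = i} {u} λ { refl → true≢false (trans (sym Vi) Vu) }

delV-absent : ∀ {n} (G : Graph n) u → V G u ≡ false → delV G u ≅ G
delV-absent G u Vu = same-V , λ i j vi vj →
  trans (cong₂ (λ a b → E G i j ∧ not a ∧ not b) (vertex≢absent G (∧-conicalˡ _ _ vi) Vu) (vertex≢absent G (∧-conicalˡ _ _ vj) Vu))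
        (∧-identityʳ (E G i j))
  where
  same-V : ∀ z → (V G z ∧ not (eqF z u)) ≡ V G z
  same-V z with eqF z u in e
  ... | false = ∧-identityʳ (V G z)
  ... | true with refl ← eqF⇒≡ {i = z} {u} e rewrite Vu = refl

induced-cong : ∀ {n} (G : Graph n) {P Q} → (∀ z → V G z ≡ true → P z ≡ Q z) → induced G P ≅ induced G Q
induced-cong G {P} {Q} P≗Q = same-V , λ i j vi vj →
  cong₂ (λ a b → E G i j ∧ a ∧ b) (P≗Q i (∧-conicalˡ _ _ vi)) (P≗Q j (∧-conicalˡ _ _ vj))
  where
  same-V : ∀ z → (V G z ∧ P z) ≡ (V G z ∧ Q z)
  same-V z with V G z in Vz
  ... | false = refl
  ... | true  = P≗Q z Vz

delV-induced : ∀ {n} (G : Graph n) P u → delV (induced G P) u ≅ induced (delV G u) P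
delV-induced G P u = (λ z → V-law (V G z) (P z) (eqF z u)) ,
                     (λ i j _ _ → E-law (E G i j) (P i) (P j) (eqF i u) (eqF j u))
  where
  V-law : ∀ x p e → (x ∧ p) ∧ not e ≡ (x ∧ not e) ∧ p
  V-law = truth-table 3 _
  E-law : ∀ x p q a b → (x ∧ p ∧ q) ∧ not a ∧ not b ≡ (x ∧ not a ∧ not b) ∧ p ∧ q
  E-law = truth-table 5 _

delV-comm : ∀ {n} (G : Graph n) u v → delV (delV G u) v ≅ delV (delV G v) u
delV-comm G u v = (λ z → V-law (V G z) (eqF z u) (eqF z v)) ,
                  (λ i j _ _ → E-law (E G i j) (eqF i u) (eqF j u) (eqF i v) (eqF j v))
  where
  V-law : ∀ x a b → (x ∧ not a) ∧ not b ≡ (x ∧ not b) ∧ not a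
  V-law = truth-table 3 _
  E-law : ∀ x a b c d → (x ∧ not a ∧ not b) ∧ not c ∧ not d ≡ (x ∧ not c ∧ not d) ∧ not a ∧ not b
  E-law = truth-table 5 _

no-vertices : ∀ {n} (G : Graph n) → verts G ≡ [] → ∀ z → V G z ≡ false
no-vertices G vs z with V G z in Vz
... | false = refl
... | true with () ← trans (sym (cong length vs)) (count-remove (V G) z Vz)

vertex-or-empty : ∀ {n} (G : Graph n) → (∀ z → V G z ≡ false) ⊎ ∃ λ u → V G u ≡ true
vertex-or-empty {n} G with verts G in vs | All-filter (V G) (allFin n) (λ _ Vz → Vz)
... | []    | _        = inj₁ (no-vertices G vs)
... | u ∷ _ | Vu ∷ _   = inj₂ (u , Vu)

verts-delV-< : ∀ {n} (G : Graph n) {u} → V G u ≡ true → length (verts (delV G u)) < length (verts G)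
verts-delV-< G {u} Vu = ℕₚ.≤-reflexive (sym (count-remove (V G) u Vu))

verts-delV-≤ : ∀ {n} (G : Graph n) u → length (verts (delV G u)) ≤ length (verts G)
verts-delV-≤ {n} G u = length-filter-mono _ (V G) (allFin n) (λ z e → ∧-conicalˡ (V G z) _ e)

verts-empty : ∀ {n} (G : Graph n) → (∀ z → V G z ≡ false) → verts G ≡ []
verts-empty {n} G none = filter-false (V G) (allFin n) (All.universal none (allFin n))

edges-empty : ∀ {n} (G : Graph n) → (∀ z → V G z ≡ false) → edges G ≡ []
edges-empty {n} G none = trans (edges≡filter-allPairs G) (filter-false (isEdge G) (allPairs n) (All.universal no-edge (allPairs n)))
  where
  no-edge : ∀ p → isEdge G p ≡ false
  no-edge (i , j) rewrite none i = ∧-zeroʳ (ltF i j)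

vertex-induction : ∀ {p n} (P : Graph n → Set p) →
  (∀ G → (∀ z → V G z ≡ false) → P G) →
  (∀ G u → V G u ≡ true → (∀ H → length (verts H) < length (verts G) → P H) → P G) →
  ∀ G → P G
vertex-induction {n = n} P empty step G = <-rec (λ k → ∀ G → length (verts G) ≡ k → P G) ind _ G refl
  where
  ind : ∀ k → (∀ {j} → j < k → ∀ G → length (verts G) ≡ j → P G) → ∀ G → length (verts G) ≡ k → P G
  ind k rec G refl with vertex-or-empty G
  ... | inj₁ none     = empty G none
  ... | inj₂ (u , Vu) = step G u Vu (λ H lt → rec lt H refl)

module _ {n} {G : Graph n} (simple : IsSimple G) where

  private
    E-sym = proj₁ simple
    E-irrefl = proj₁ (proj₂ simple)
    E⇒V = proj₂ (proj₂ simple)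

  adjacent⇒vertexˡ : ∀ u v → E G u v ≡ true → V G u ≡ true
  adjacent⇒vertexˡ = E⇒V

  adjacent⇒vertexʳ : ∀ u v → E G u v ≡ true → V G v ≡ true
  adjacent⇒vertexʳ u v e = E⇒V v u (trans (E-sym v u) e)

  adjacent⇒distinct : ∀ u v → E G u v ≡ true → eqF v u ≡ false
  adjacent⇒distinct u v e = ≢⇒eqF≡false {i = v} {u} λ { refl → true≢false (trans (sym e) (E-irrefl v)) }

  edge⇒isEdge : ∀ u v → E G u v ≡ true → ltF u v ≡ true → isEdge G (u , v) ≡ true
  edge⇒isEdge u v e lt rewrite lt | adjacent⇒vertexˡ u v e | adjacent⇒vertexʳ u v e | e = refl

  IsSimple-delV : ∀ u → IsSimple (delV G u)
  IsSimple-delV u = (λ i j → trans (cong (_∧ _) (E-sym i j)) (∧-swap₂ (E G j i) (not (eqF i u)) (not (eqF j u)))) ,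
                    (λ i → cong (_∧ _) (E-irrefl i)) ,
                    (λ i j e → cong₂ _∧_ (E⇒V i j (∧-conicalˡ (E G i j) _ e))
                                          (∧-conicalˡ (not (eqF i u)) _ (∧-conicalʳ (E G i j) _ e)))
    where
    ∧-swap₂ : ∀ x a b → x ∧ a ∧ b ≡ x ∧ b ∧ a
    ∧-swap₂ = truth-table 3 _

  IsSimple-induced : ∀ P → IsSimple (induced G P)
  IsSimple-induced P = (λ i j → trans (cong (_∧ _) (E-sym i j)) (∧-swap₂ (E G j i) (P i) (P j))) ,
                       (λ i → cong (_∧ _) (E-irrefl i)) ,
                       (λ i j e → cong₂ _∧_ (E⇒V i j (∧-conicalˡ (E G i j) _ e))
                                             (∧-conicalˡ (P i) _ (∧-conicalʳ (E G i j) _ e)))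
    where
    ∧-swap₂ : ∀ x a b → x ∧ a ∧ b ≡ x ∧ b ∧ a
    ∧-swap₂ = truth-table 3 _

  IsSimple-delE : ∀ u v → IsSimple (delE G u v)
  IsSimple-delE u v = (λ i j → cong₂ _∧_ (E-sym i j) (cong not (rem-sym (eqF i u) (eqF j v) (eqF i v) (eqF j u)))) ,
                      (λ i → cong (_∧ _) (E-irrefl i)) ,
                      (λ i j e → E⇒V i j (∧-conicalˡ _ _ e))
    where
    rem-sym : ∀ a b c d → (a ∧ b) ∨ (c ∧ d) ≡ (d ∧ c) ∨ (b ∧ a)
    rem-sym = truth-table 4 _

nonEdge⇒¬isEdge : ∀ {n} (G : Graph n) i j → E G i j ≡ false → isEdge G (i , j) ≡ false
nonEdge⇒¬isEdge G i j e rewrite e = ∧-false (ltF i j) (V G i) (V G j)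
  where
  ∧-false : ∀ x y z → x ∧ y ∧ z ∧ false ≡ false
  ∧-false = truth-table 3 _

¬ordered⇒¬isEdge : ∀ {n} (G : Graph n) i j → ltF i j ≡ false → isEdge G (i , j) ≡ false
¬ordered⇒¬isEdge G i j lt rewrite lt = refl

IsSimple-union : ∀ {n} {G H : Graph n} → IsSimple G → IsSimple H → IsSimple (union G H)
IsSimple-union {G = G} {H} (s , l , ev) (s′ , l′ , ev′) =
  (λ i j → cong₂ _∨_ (s i j) (s′ i j)) , (λ i → cong₂ _∨_ (l i) (l′ i)) , E⇒V
  where
  E⇒V : ∀ i j → (E G i j ∨ E H i j) ≡ true → (V G i ∨ V H i) ≡ true
  E⇒V i j e with E G i j in eG
  ... | true  rewrite ev i j eG = refl
  ... | false rewrite ev′ i j e = ∨-zeroʳ (V G i)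

Disjoint : ∀ {n} → Graph n → Graph n → Set
Disjoint G H = ∀ z → (V G z ∧ V H z) ≡ false

Disjoint-delV : ∀ {n} (G : Graph n) {H : Graph n} u → Disjoint G H → Disjoint (delV G u) H
Disjoint-delV G {H} u disjoint z with V G z | disjoint z
... | false | _  = refl
... | true  | Hz rewrite Hz = ∧-zeroʳ _

delV-union : ∀ {n} (G H : Graph n) → IsSimple H → ∀ u → V H u ≡ false → delV (union G H) u ≅ union (delV G u) H
delV-union G H simple u Hu = same-V , same-E
  where
  outside-H : ∀ i → V H i ≡ true → eqF i u ≡ false
  outside-H i Hi = vertex≢absent H Hi Hu
  same-V : ∀ z → ((V G z ∨ V H z) ∧ not (eqF z u)) ≡ ((V G z ∧ not (eqF z u)) ∨ V H z)
  same-V z with eqF z u in e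
  ... | false = trans (∧-identityʳ _) (cong (_∨ V H z) (sym (∧-identityʳ (V G z))))
  ... | true with refl ← eqF⇒≡ {i = z} {u} e rewrite Hu = V-law (V G u)
    where
    V-law : ∀ x → (x ∨ false) ∧ false ≡ (x ∧ false) ∨ false
    V-law = truth-table 1 _
  same-E : ∀ i j → _ → _ → ((E G i j ∨ E H i j) ∧ not (eqF i u) ∧ not (eqF j u)) ≡ ((E G i j ∧ not (eqF i u) ∧ not (eqF j u)) ∨ E H i j)
  same-E i j _ _ with E H i j in Hij
  ... | false = E-law (E G i j) (eqF i u) (eqF j u)
    where
    E-law : ∀ x a b → (x ∨ false) ∧ not a ∧ not b ≡ (x ∧ not a ∧ not b) ∨ false
    E-law = truth-table 3 _
  ... | true rewrite outside-H i (adjacent⇒vertexˡ simple i j Hij) | outside-H j (adjacent⇒vertexʳ simple i j Hij) =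
    E-law (E G i j)
    where
    E-law : ∀ x → (x ∨ true) ∧ true ∧ true ≡ (x ∧ true ∧ true) ∨ true
    E-law = truth-table 1 _

Within : ∀ {n} → (Fin n → Bool) → Fin n × Fin n → Set
Within P (a , b) = eqF a b ≡ false × P a ≡ true × P b ≡ true

edges-within : ∀ {n} (G : Graph n) → All (Within (V G)) (edges G)
edges-within {n} G = subst (All (Within (V G))) (sym (edges≡filter-allPairs G))
                           (All-filter (isEdge G) (allPairs n) within)
  where
  within : ∀ e → isEdge G e ≡ true → Within (V G) e
  within (i , j) e with ltF i j in lt | V G i in vi | V G j in vj
  ... | true | true | true = ltF⇒eqF≡false {i = i} {j} lt , refl , refl

matching-size : ∀ {n} (P : Fin n → Bool) (S : List (Fin n × Fin n)) →
                All (Within P) S → isMatching S ≡ true → 2 ℕ.* length S ≤ count P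
matching-size P [] _ _ = z≤n
matching-size {n} P ((a , b) ∷ S) ((a≢b , Pa , Pb) ∷ within) matching =
  subst (_≤ count P) (sym (ℕₚ.*-suc 2 (length S)))
    (subst (suc (suc (2 ℕ.* length S)) ≤_) (sym (trans (count-remove P a Pa) (cong suc (count-remove P₋a b P₋a-b))))
      (s≤s (s≤s (matching-size P₋ab S (avoid S within (∧-conicalˡ _ _ matching)) (∧-conicalʳ _ _ matching)))))
  where
  P₋a P₋ab : Fin n → Bool
  P₋a z = P z ∧ not (eqF z a)
  P₋ab z = P₋a z ∧ not (eqF z b)
  P₋a-b : P₋a b ≡ true
  P₋a-b = cong₂ _∧_ Pb (cong not (trans (eqF-sym b a) a≢b))
  avoid : ∀ T → All (Within P) T → allB (disjointE (a , b)) T ≡ true → All (Within P₋ab) T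
  avoid [] _ _ = []
  avoid ((c , d) ∷ T) ((c≢d , Pc , Pd) ∷ within) dj
    with disjointE⇒distinct {a = a} {b} {c} {d} (∧-conicalˡ _ _ dj)
  ... | ac , ad , bc , bd =
    (c≢d , keep c Pc (trans (eqF-sym c a) ac) (trans (eqF-sym c b) bc)
         , keep d Pd (trans (eqF-sym d a) ad) (trans (eqF-sym d b) bd))
    ∷ avoid T within (∧-conicalʳ _ _ dj)
    where
    keep : ∀ z → P z ≡ true → eqF z a ≡ false → eqF z b ≡ false → P₋ab z ≡ true
    keep z Pz za zb rewrite Pz | za | zb = refl

-- Polynomials

module Polynomials {c ℓ} (R : CommutativeRing c ℓ) where

  open CommutativeRing R renaming (refl to ≈-refl; sym to ≈-sym; trans to ≈-trans)
  open WithRing R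
  open NonReflective (fromCommutativeRing R (λ _ → nothing))
    using (solve; _⊜_) renaming (_⊕_ to _:+_; _⊗_ to _:*_; ⊝_ to :-_)
  open RingProperties ring using (-‿distribˡ-*; -‿distribʳ-*; -‿+-comm; -0#≈0#; -‿involutive)

  +-interchange : ∀ a b c d → (a + b) + (c + d) ≈ (a + c) + (b + d)
  +-interchange = solve 4 (λ a b c d → ((a :+ b) :+ (c :+ d)) ⊜ ((a :+ c) :+ (b :+ d))) ≈-refl

  +-leftComm : ∀ a b c → a + (b + c) ≈ b + (a + c)
  +-leftComm = solve 3 (λ a b c → (a :+ (b :+ c)) ⊜ (b :+ (a :+ c))) ≈-refl

  *-leftComm : ∀ a b c → a * (b * c) ≈ b * (a * c)
  *-leftComm = solve 3 (λ a b c → (a :* (b :* c)) ⊜ (b :* (a :* c))) ≈-refl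

  ≋-refl : ∀ {p} → p ≋ p
  ≋-refl k = ≈-refl

  ≋-sym : ∀ {p q} → p ≋ q → q ≋ p
  ≋-sym e k = ≈-sym (e k)

  ≋-trans : ∀ {p q r} → p ≋ q → q ≋ r → p ≋ r
  ≋-trans e f k = ≈-trans (e k) (f k)

  ≋-reflexive : ∀ {p q} → p ≡ q → p ≋ q
  ≋-reflexive refl = ≋-refl

  ≋-setoid : Setoid c ℓ
  ≋-setoid = record { Carrier = Poly ; _≈_ = _≋_
                    ; isEquivalence = record { refl = ≋-refl ; sym = ≋-sym ; trans = ≋-trans } }

  module ≋-Reasoning = SetoidReasoning ≋-setoid

  ⊕-cong : ∀ {p p′ q q′} → p ≋ p′ → q ≋ q′ → (p ⊕ q) ≋ (p′ ⊕ q′)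
  ⊕-cong e f k = +-cong (e k) (f k)

  ⊖-cong : ∀ {p p′ q q′} → p ≋ p′ → q ≋ q′ → (p ⊖ q) ≋ (p′ ⊖ q′)
  ⊖-cong e f k = +-cong (e k) (-‿cong (f k))

  ⊛-cong : ∀ {a a′ p p′} → a ≈ a′ → p ≋ p′ → (a ⊛ p) ≋ (a′ ⊛ p′)
  ⊛-cong e f k = *-cong e (f k)

  ⊕-identityˡ : ∀ p → (zeroP ⊕ p) ≋ p
  ⊕-identityˡ p k = +-identityˡ (p k)

  ⊕-identityʳ : ∀ p → (p ⊕ zeroP) ≋ p
  ⊕-identityʳ p k = +-identityʳ (p k)

  ⊛-distrib-⊖ : ∀ a p q → (a ⊛ (p ⊖ q)) ≋ ((a ⊛ p) ⊖ (a ⊛ q))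
  ⊛-distrib-⊖ a p q k = ≈-trans (distribˡ _ _ _) (+-cong ≈-refl (≈-sym (-‿distribʳ-* _ _)))

  ifᵖ : Bool → Poly → Poly
  ifᵖ b p = if b then p else zeroP

  ifᵖ-true : ∀ {b p} → b ≡ true → ifᵖ b p ≋ p
  ifᵖ-true refl = ≋-refl

  ifᵖ-false : ∀ {b p} → b ≡ false → ifᵖ b p ≋ zeroP
  ifᵖ-false refl = ≋-refl

  ifᵖ-cong : ∀ {b b′ p q} → b ≡ b′ → (b ≡ true → p ≋ q) → ifᵖ b p ≋ ifᵖ b′ q
  ifᵖ-cong {true}  refl h = h refl
  ifᵖ-cong {false} refl h = ≋-refl

  ifᵖ-∧ : ∀ b c p → ifᵖ (b ∧ c) p ≋ ifᵖ b (ifᵖ c p)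
  ifᵖ-∧ true  c p = ≋-refl
  ifᵖ-∧ false c p = ≋-refl

  Σ : ∀ {a} {A : Set a} → List A → (A → Poly) → Poly
  Σ L f = polySum (map f L)

  module _ {a} {A : Set a} where

    Σ-cong : ∀ (L : List A) {f g : A → Poly} → (∀ x → f x ≋ g x) → Σ L f ≋ Σ L g
    Σ-cong []      e k = ≈-refl
    Σ-cong (x ∷ L) e k = +-cong (e x k) (Σ-cong L e k)

    Σ-congᴬ : ∀ {ℓ′} {P : A → Set ℓ′} (L : List A) {f g : A → Poly} →
              All P L → (∀ x → P x → f x ≋ g x) → Σ L f ≋ Σ L g
    Σ-congᴬ []      _        e k = ≈-refl
    Σ-congᴬ (x ∷ L) (px ∷ pL) e k = +-cong (e x px k) (Σ-congᴬ L pL e k)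

    Σ-≡ : ∀ {L L′ : List A} (f : A → Poly) → L ≡ L′ → Σ L f ≋ Σ L′ f
    Σ-≡ f refl = ≋-refl

    Σ-++ : ∀ (L L′ : List A) (f : A → Poly) → Σ (L ++ L′) f ≋ (Σ L f ⊕ Σ L′ f)
    Σ-++ []      L′ f k = ≈-sym (+-identityˡ _)
    Σ-++ (x ∷ L) L′ f k = ≈-trans (+-cong ≈-refl (Σ-++ L L′ f k)) (≈-sym (+-assoc _ _ _))

    Σ-zero : ∀ (L : List A) → Σ L (λ _ → zeroP) ≋ zeroP
    Σ-zero []      k = ≈-refl
    Σ-zero (x ∷ L) k = ≈-trans (+-identityˡ _) (Σ-zero L k)

    Σ-⊕ : ∀ (L : List A) (f g : A → Poly) → Σ L (λ x → f x ⊕ g x) ≋ (Σ L f ⊕ Σ L g)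
    Σ-⊕ []      f g k = ≈-sym (+-identityˡ _)
    Σ-⊕ (x ∷ L) f g k = ≈-trans (+-cong ≈-refl (Σ-⊕ L f g k)) (+-interchange _ _ _ _)

    Σ-⊖ : ∀ (L : List A) (f g : A → Poly) → Σ L (λ x → f x ⊖ g x) ≋ (Σ L f ⊖ Σ L g)
    Σ-⊖ []      f g k = ≈-trans (≈-sym (+-identityʳ 0#)) (+-cong ≈-refl (≈-sym -0#≈0#))
    Σ-⊖ (x ∷ L) f g k = ≈-trans (+-cong ≈-refl (Σ-⊖ L f g k))
      (solve 4 (λ a b c d → ((a :+ (:- b)) :+ (c :+ (:- d))) ⊜ ((a :+ c) :+ (:- (b :+ d)))) ≈-refl
             (f x k) (g x k) (Σ L f k) (Σ L g k))

    Σ-⊛ : ∀ (L : List A) (a : Carrier) (f : A → Poly) → Σ L (λ x → a ⊛ f x) ≋ (a ⊛ Σ L f)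
    Σ-⊛ []      a f k = ≈-sym (zeroʳ a)
    Σ-⊛ (x ∷ L) a f k = ≈-trans (+-cong ≈-refl (Σ-⊛ L a f k)) (≈-sym (distribˡ a _ _))

    Σ-ifᵖ : ∀ (L : List A) (b : Bool) (f : A → Poly) → Σ L (λ x → ifᵖ b (f x)) ≋ ifᵖ b (Σ L f)
    Σ-ifᵖ L true  f = ≋-refl
    Σ-ifᵖ L false f = Σ-zero L

    Σ-filter : ∀ (p : A → Bool) (L : List A) (f : A → Poly) → Σ (filterᵇ p L) f ≋ Σ L (λ x → ifᵖ (p x) (f x))
    Σ-filter p []      f k = ≈-refl
    Σ-filter p (x ∷ L) f k with p x
    ... | true  = +-cong ≈-refl (Σ-filter p L f k)
    ... | false = ≈-trans (Σ-filter p L f k) (≈-sym (+-identityˡ _))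

    Σ-↭ : ∀ {L L′ : List A} (f : A → Poly) → L ↭ L′ → Σ L f ≋ Σ L′ f
    Σ-↭ f Perm.refl        k = ≈-refl
    Σ-↭ f (prep x p)       k = +-cong ≈-refl (Σ-↭ f p k)
    Σ-↭ f (swap x y p)     k = ≈-trans (+-cong ≈-refl (+-cong ≈-refl (Σ-↭ f p k))) (+-leftComm _ _ _)
    Σ-↭ f (Perm.trans p q) k = ≈-trans (Σ-↭ f p k) (Σ-↭ f q k)

  Σ-map : ∀ {a b} {A : Set a} {B : Set b} (h : A → B) (L : List A) (f : B → Poly) → Σ (map h L) f ≋ Σ L (f ∘ h)
  Σ-map h []      f k = ≈-refl
  Σ-map h (x ∷ L) f k = +-cong ≈-refl (Σ-map h L f k)

  Σ-comm : ∀ {a b} {A : Set a} {B : Set b} (L : List A) (L′ : List B) (f : A → B → Poly) →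
           Σ L (λ x → Σ L′ (f x)) ≋ Σ L′ (λ y → Σ L (λ x → f x y))
  Σ-comm []      L′ f = ≋-sym (Σ-zero L′)
  Σ-comm (x ∷ L) L′ f = ≋-trans (⊕-cong ≋-refl (Σ-comm L L′ f)) (≋-sym (Σ-⊕ L′ (f x) _))

  Σ-concatMap : ∀ {a b} {A : Set a} {B : Set b} (g : A → List B) (L : List A) (f : B → Poly) →
                Σ (concatMap g L) f ≋ Σ L (λ x → Σ (g x) f)
  Σ-concatMap g []      f k = ≈-refl
  Σ-concatMap g (x ∷ L) f = ≋-trans (Σ-++ (g x) (concatMap g L) f) (⊕-cong ≋-refl (Σ-concatMap g L f))

  Σ-allFin-eqF : ∀ {n} (u : Fin n) (f : Fin n → Poly) → Σ (allFin n) (λ z → ifᵖ (eqF z u) (f z)) ≋ f u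
  Σ-allFin-eqF {n} u f = ≋-trans (≋-sym (Σ-filter (λ z → eqF z u) (allFin n) f))
    (≋-trans (Σ-≡ f (filter-eqF-allFin u)) (λ k → +-identityʳ _))

  Σ-neg : ∀ {a} {A : Set a} (L : List A) (f : A → Poly) → Σ L (λ x → zeroP ⊖ f x) ≋ (zeroP ⊖ Σ L f)
  Σ-neg L f = ≋-trans (Σ-⊖ L (λ _ → zeroP) f) (⊖-cong (Σ-zero L) ≋-refl)

  Σ-filter² : ∀ {a b} {A : Set a} {B : Set b} (p : A → Bool) (q : A → B → Bool) (L : List A) (L′ : List B) (f : A → B → Poly) →
    Σ (filterᵇ p L) (λ x → Σ (filterᵇ (q x) L′) (f x)) ≋ Σ L (λ x → Σ L′ (λ y → ifᵖ (p x ∧ q x y) (f x y)))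
  Σ-filter² p q L L′ f = ≋-trans (Σ-filter p L _) (Σ-cong L inner)
    where
    inner : ∀ x → ifᵖ (p x) (Σ (filterᵇ (q x) L′) (f x)) ≋ Σ L′ (λ y → ifᵖ (p x ∧ q x y) (f x y))
    inner x with p x
    ... | true  = Σ-filter (q x) L′ (f x)
    ... | false = ≋-sym (Σ-zero L′)

  module _ {a} {A : Set a} where

    Σsubs : List A → (List A → Poly) → Poly
    Σsubs L F = Σ (subs L) F

    Σsubs-∷ : ∀ x L (F : List A → Poly) → Σsubs (x ∷ L) F ≋ (Σsubs L F ⊕ Σsubs L (F ∘ (x ∷_)))
    Σsubs-∷ x L F = ≋-trans (Σ-++ (subs L) (map (x ∷_) (subs L)) F) (⊕-cong ≋-refl (Σ-map (x ∷_) (subs L) F))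

    PermInvariant : (List A → Poly) → Set (a ⊔ ℓ)
    PermInvariant F = ∀ {S S′} → S ↭ S′ → F S ≋ F S′

    Σsubs-↭ : ∀ {L L′} (F : List A → Poly) → PermInvariant F → L ↭ L′ → Σsubs L F ≋ Σsubs L′ F
    Σsubs-↭ F inv Perm.refl = ≋-refl
    Σsubs-↭ F inv (prep {xs} {ys} x p) = ≋-trans (Σsubs-∷ x xs F) (≋-trans
      (⊕-cong (Σsubs-↭ F inv p) (Σsubs-↭ (F ∘ (x ∷_)) (inv ∘ prep x) p)) (≋-sym (Σsubs-∷ x ys F)))
    Σsubs-↭ F inv (swap {xs} {ys} x y p) = begin
      Σsubs (x ∷ y ∷ xs) F
        ≈⟨ ≋-trans (Σsubs-∷ x (y ∷ xs) F) (⊕-cong (Σsubs-∷ y xs F) (Σsubs-∷ y xs (F ∘ (x ∷_)))) ⟩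
      (Σsubs xs F ⊕ Σsubs xs (F ∘ (y ∷_))) ⊕ (Σsubs xs (F ∘ (x ∷_)) ⊕ Σsubs xs (F ∘ (λ S → x ∷ y ∷ S)))
        ≈⟨ (λ k → +-interchange _ _ _ _) ⟩
      (Σsubs xs F ⊕ Σsubs xs (F ∘ (x ∷_))) ⊕ (Σsubs xs (F ∘ (y ∷_)) ⊕ Σsubs xs (F ∘ (λ S → x ∷ y ∷ S)))
        ≈⟨ ⊕-cong (⊕-cong (Σsubs-↭ F inv p) (Σsubs-↭ (F ∘ (x ∷_)) (inv ∘ prep x) p))
                  (⊕-cong (Σsubs-↭ (F ∘ (y ∷_)) (inv ∘ prep y) p)
                          (≋-trans (Σsubs-↭ (F ∘ (λ S → x ∷ y ∷ S)) (inv ∘ prep x ∘ prep y) p)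
                                   (Σ-cong (subs ys) (λ S → inv (swap x y Perm.refl))))) ⟩
      (Σsubs ys F ⊕ Σsubs ys (F ∘ (x ∷_))) ⊕ (Σsubs ys (F ∘ (y ∷_)) ⊕ Σsubs ys (F ∘ (λ S → y ∷ x ∷ S)))
        ≈⟨ ≋-sym (≋-trans (Σsubs-∷ y (x ∷ ys) F) (⊕-cong (Σsubs-∷ x ys F) (Σsubs-∷ x ys (F ∘ (y ∷_))))) ⟩
      Σsubs (y ∷ x ∷ ys) F ∎
      where open ≋-Reasoning
    Σsubs-↭ F inv (Perm.trans p q) = ≋-trans (Σsubs-↭ F inv p) (Σsubs-↭ F inv q)

    Σsubs-allB : ∀ (q : A → Bool) L (F : List A → Poly) → Σsubs L (λ S → ifᵖ (allB q S) (F S)) ≋ Σsubs (filterᵇ q L) F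
    Σsubs-allB q []      F k = ≈-refl
    Σsubs-allB q (x ∷ L) F with q x in e
    ... | true  = ≋-trans (Σsubs-∷ x L _)
                  (≋-trans (⊕-cong (Σsubs-allB q L F)
                                   (≋-trans (Σ-cong (subs L) (λ S → ifᵖ-cong (cong (_∧ allB q S) e) (λ _ → ≋-refl)))
                                            (Σsubs-allB q L (F ∘ (x ∷_)))))
                           (≋-sym (Σsubs-∷ x (filterᵇ q L) F)))
    ... | false = ≋-trans (Σsubs-∷ x L _)
                  (≋-trans (⊕-cong (Σsubs-allB q L F)
                                   (≋-trans (Σ-cong (subs L) (λ S → ifᵖ-false (cong (_∧ allB q S) e))) (Σ-zero (subs L))))
                           (λ k → +-identityʳ _))

  shift : Poly → Poly
  shift p zero    = 0#
  shift p (suc k) = p k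

  shift-cong : ∀ {p q} → p ≋ q → shift p ≋ shift q
  shift-cong e zero    = ≈-refl
  shift-cong e (suc k) = e k

  shift-⊕ : ∀ p q → shift (p ⊕ q) ≋ (shift p ⊕ shift q)
  shift-⊕ p q zero    = ≈-sym (+-identityˡ 0#)
  shift-⊕ p q (suc k) = ≈-refl

  shift-⊛ : ∀ a p → shift (a ⊛ p) ≋ (a ⊛ shift p)
  shift-⊛ a p zero    = ≈-sym (zeroʳ a)
  shift-⊛ a p (suc k) = ≈-refl

  shift-Σ : ∀ {a} {A : Set a} (L : List A) (f : A → Poly) → shift (Σ L f) ≋ Σ L (shift ∘ f)
  shift-Σ []      f zero    = ≈-refl
  shift-Σ []      f (suc k) = ≈-refl
  shift-Σ (x ∷ L) f = ≋-trans (shift-⊕ (f x) (Σ L f)) (⊕-cong ≋-refl (shift-Σ L f))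

  shift-xpow : ∀ m → shift (xpow m) ≋ xpow (suc m)
  shift-xpow m zero    = ≈-refl
  shift-xpow m (suc k) = ≈-refl

  shift-zeroP : shift zeroP ≋ zeroP
  shift-zeroP zero    = ≈-refl
  shift-zeroP (suc k) = ≈-refl

  sumUpTo : (ℕ → Carrier) → ℕ → Carrier
  sumUpTo f m = sumR (applyUpTo f m)

  ⊗-sumUpTo : ∀ p q k → (p ⊗ q) k ≡ sumUpTo (λ i → p i * q (k ∸ i)) (suc k)
  ⊗-sumUpTo p q k = cong sumR (map-applyUpTo (λ i → p i * q (k ∸ i)) (λ i → i) (suc k))
    where
    map-applyUpTo : (f : ℕ → Carrier) (g : ℕ → ℕ) (m : ℕ) → map f (applyUpTo g m) ≡ applyUpTo (f ∘ g) m
    map-applyUpTo f g zero    = refl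
    map-applyUpTo f g (suc m) = cong (f (g 0) ∷_) (map-applyUpTo f (g ∘ suc) m)

  sumUpTo-cong : ∀ {f g} m → (∀ i → f i ≈ g i) → sumUpTo f m ≈ sumUpTo g m
  sumUpTo-cong zero    e = ≈-refl
  sumUpTo-cong {f} {g} (suc m) e = +-cong (e 0) (sumUpTo-cong {f ∘ suc} {g ∘ suc} m (e ∘ suc))

  sumUpTo-+ : ∀ f g m → sumUpTo (λ i → f i + g i) m ≈ sumUpTo f m + sumUpTo g m
  sumUpTo-+ f g zero    = ≈-sym (+-identityˡ 0#)
  sumUpTo-+ f g (suc m) = ≈-trans (+-cong ≈-refl (sumUpTo-+ (f ∘ suc) (g ∘ suc) m)) (+-interchange _ _ _ _)

  sumUpTo-* : ∀ a f m → sumUpTo (λ i → a * f i) m ≈ a * sumUpTo f m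
  sumUpTo-* a f zero    = ≈-sym (zeroʳ a)
  sumUpTo-* a f (suc m) = ≈-trans (+-cong ≈-refl (sumUpTo-* a (f ∘ suc) m)) (≈-sym (distribˡ a _ _))

  sumUpTo-neg : ∀ f m → sumUpTo (λ i → - f i) m ≈ - sumUpTo f m
  sumUpTo-neg f zero    = ≈-sym -0#≈0#
  sumUpTo-neg f (suc m) = ≈-trans (+-cong ≈-refl (sumUpTo-neg (f ∘ suc) m)) (-‿+-comm _ _)

  sumUpTo-zero : ∀ {f} m → (∀ i → f i ≈ 0#) → sumUpTo f m ≈ 0#
  sumUpTo-zero zero    e = ≈-refl
  sumUpTo-zero (suc m) e = ≈-trans (+-cong (e 0) (sumUpTo-zero m (e ∘ suc))) (+-identityˡ 0#)

  ⊗-congˡ : ∀ {p p′} q → p ≋ p′ → (p ⊗ q) ≋ (p′ ⊗ q)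
  ⊗-congˡ {p} {p′} q e k rewrite ⊗-sumUpTo p q k | ⊗-sumUpTo p′ q k =
    sumUpTo-cong (suc k) (λ i → *-cong (e i) (≈-refl {q (k ∸ i)}))

  ⊗-distribʳ-⊕ : ∀ p p′ q → ((p ⊕ p′) ⊗ q) ≋ ((p ⊗ q) ⊕ (p′ ⊗ q))
  ⊗-distribʳ-⊕ p p′ q k rewrite ⊗-sumUpTo (p ⊕ p′) q k | ⊗-sumUpTo p q k | ⊗-sumUpTo p′ q k =
    ≈-trans (sumUpTo-cong (suc k) (λ i → distribʳ (q (k ∸ i)) (p i) (p′ i))) (sumUpTo-+ (λ i → p i * q (k ∸ i)) (λ i → p′ i * q (k ∸ i)) (suc k))

  ⊗-distribʳ-⊖ : ∀ p p′ q → ((p ⊖ p′) ⊗ q) ≋ ((p ⊗ q) ⊖ (p′ ⊗ q))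
  ⊗-distribʳ-⊖ p p′ q k rewrite ⊗-sumUpTo (p ⊖ p′) q k | ⊗-sumUpTo p q k | ⊗-sumUpTo p′ q k =
    ≈-trans (sumUpTo-cong (suc k) (λ i → ≈-trans (distribʳ (q (k ∸ i)) (p i) (- p′ i))
                                                  (+-cong ≈-refl (≈-sym (-‿distribˡ-* (p′ i) (q (k ∸ i)))))))
      (≈-trans (sumUpTo-+ (λ i → p i * q (k ∸ i)) (λ i → - (p′ i * q (k ∸ i))) (suc k))
               (+-cong ≈-refl (sumUpTo-neg (λ i → p′ i * q (k ∸ i)) (suc k))))

  ⊗-⊛ˡ : ∀ a p q → ((a ⊛ p) ⊗ q) ≋ (a ⊛ (p ⊗ q))
  ⊗-⊛ˡ a p q k rewrite ⊗-sumUpTo (a ⊛ p) q k | ⊗-sumUpTo p q k =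
    ≈-trans (sumUpTo-cong (suc k) (λ i → *-assoc a (p i) (q (k ∸ i)))) (sumUpTo-* a (λ i → p i * q (k ∸ i)) (suc k))

  ⊗-zeroˡ : ∀ q → (zeroP ⊗ q) ≋ zeroP
  ⊗-zeroˡ q k rewrite ⊗-sumUpTo zeroP q k = sumUpTo-zero (suc k) (λ i → zeroˡ (q (k ∸ i)))

  ⊗-Σˡ : ∀ {a} {A : Set a} (L : List A) (f : A → Poly) q → (Σ L f ⊗ q) ≋ Σ L (λ x → f x ⊗ q)
  ⊗-Σˡ []      f q = ⊗-zeroˡ q
  ⊗-Σˡ (x ∷ L) f q = ≋-trans (⊗-distribʳ-⊕ (f x) (Σ L f) q) (⊕-cong ≋-refl (⊗-Σˡ L f q))

  ⊗-shiftˡ : ∀ p q → (shift p ⊗ q) ≋ shift (p ⊗ q)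
  ⊗-shiftˡ p q zero = ≈-trans (+-cong (zeroˡ _) ≈-refl) (+-identityˡ 0#)
  ⊗-shiftˡ p q (suc k) rewrite ⊗-sumUpTo (shift p) q (suc k) | ⊗-sumUpTo p q k =
    ≈-trans (+-cong (zeroˡ _) ≈-refl) (+-identityˡ _)

  ⊗-constˡ : ∀ a q → (constP a ⊗ q) ≋ (a ⊛ q)
  ⊗-constˡ a q k rewrite ⊗-sumUpTo (constP a) q k =
    ≈-trans (+-cong ≈-refl (sumUpTo-zero k (λ i → zeroˡ _))) (+-identityʳ _)

  ⊗-Xˡ : ∀ q → (X ⊗ q) ≋ shift q
  ⊗-Xˡ q zero = ≈-trans (+-cong (zeroˡ _) ≈-refl) (+-identityˡ 0#)
  ⊗-Xˡ q (suc k) rewrite ⊗-sumUpTo X q (suc k) =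
    ≈-trans (+-identityˡ′ (zeroˡ _))
      (≈-trans (+-cong (*-identityˡ _) (sumUpTo-zero k (λ i → zeroˡ _))) (+-identityʳ _))
    where
    +-identityˡ′ : ∀ {a b} → a ≈ 0# → a + b ≈ b
    +-identityˡ′ a≈0 = ≈-trans (+-cong a≈0 ≈-refl) (+-identityˡ _)

  ⊗-X-constˡ : ∀ a q → ((X ⊖ constP a) ⊗ q) ≋ (shift q ⊖ (a ⊛ q))
  ⊗-X-constˡ a q = ≋-trans (⊗-distribʳ-⊖ X (constP a) q) (⊖-cong (⊗-Xˡ q) (⊗-constˡ a q))

  natMul-cong : ∀ m {a b} → a ≈ b → natMul m a ≈ natMul m b
  natMul-cong zero    e = ≈-refl
  natMul-cong (suc m) e = +-cong e (natMul-cong m e)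

  natMul-+ : ∀ m a b → natMul m (a + b) ≈ natMul m a + natMul m b
  natMul-+ zero    a b = ≈-sym (+-identityˡ 0#)
  natMul-+ (suc m) a b = ≈-trans (+-cong ≈-refl (natMul-+ m a b)) (+-interchange _ _ _ _)

  natMul-* : ∀ m a b → natMul m (a * b) ≈ a * natMul m b
  natMul-* zero    a b = ≈-sym (zeroʳ a)
  natMul-* (suc m) a b = ≈-trans (+-cong ≈-refl (natMul-* m a b)) (≈-sym (distribˡ a _ _))

  natMul-neg : ∀ m a → natMul m (- a) ≈ - natMul m a
  natMul-neg zero    a = ≈-sym -0#≈0#
  natMul-neg (suc m) a = ≈-trans (+-cong ≈-refl (natMul-neg m a)) (-‿+-comm _ _)

  natMul-zero : ∀ m → natMul m 0# ≈ 0#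
  natMul-zero zero    = ≈-refl
  natMul-zero (suc m) = ≈-trans (+-identityˡ _) (natMul-zero m)

  D-cong : ∀ {p q} → p ≋ q → D p ≋ D q
  D-cong e k = natMul-cong (suc k) (e (suc k))

  D-⊕ : ∀ p q → D (p ⊕ q) ≋ (D p ⊕ D q)
  D-⊕ p q k = natMul-+ (suc k) _ _

  D-⊖ : ∀ p q → D (p ⊖ q) ≋ (D p ⊖ D q)
  D-⊖ p q k = ≈-trans (natMul-+ (suc k) _ _) (+-cong ≈-refl (natMul-neg (suc k) _))

  D-⊛ : ∀ a p → D (a ⊛ p) ≋ (a ⊛ D p)
  D-⊛ a p k = natMul-* (suc k) _ _

  D-Σ : ∀ {a} {A : Set a} (L : List A) (f : A → Poly) → D (Σ L f) ≋ Σ L (D ∘ f)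
  D-Σ []      f k = natMul-zero (suc k)
  D-Σ (x ∷ L) f = ≋-trans (D-⊕ (f x) (Σ L f)) (⊕-cong ≋-refl (D-Σ L f))

  D-const : ∀ a → D (constP a) ≋ zeroP
  D-const a k = natMul-zero (suc k)

  D-shift : ∀ p → D (shift p) ≋ (p ⊕ shift (D p))
  D-shift p zero    = ≈-trans (+-identityʳ _) (≈-sym (+-identityʳ _))
  D-shift p (suc k) = ≈-refl

  prodR-map-↭ : ∀ {a} {A : Set a} (f : A → Carrier) {L L′} → L ↭ L′ → prodR (map f L) ≈ prodR (map f L′)
  prodR-map-↭ f Perm.refl        = ≈-refl
  prodR-map-↭ f (prep x p)       = *-cong ≈-refl (prodR-map-↭ f p)
  prodR-map-↭ f (swap x y p)     = ≈-trans (*-cong ≈-refl (*-cong ≈-refl (prodR-map-↭ f p))) (*-leftComm _ _ _)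
  prodR-map-↭ f (Perm.trans p q) = ≈-trans (prodR-map-↭ f p) (prodR-map-↭ f q)

  normSq-cong : ∀ {z z′} → z ≈C z′ → normSq z ≈ normSq z′
  normSq-cong (re≈ , im≈) = +-cong (*-cong re≈ re≈) (*-cong im≈ im≈)

  normSq-oneC : normSq oneC ≈ 1#
  normSq-oneC = ≈-trans (+-cong (*-identityˡ 1#) (zeroˡ 0#)) (+-identityʳ 1#)

  -- Without a zero test the ring solver cannot cancel the cross terms; they are cancelled by hand.
  normSq-mulC : ∀ z z′ → normSq (mulC z z′) ≈ normSq z * normSq z′
  normSq-mulC (a +i b) (a′ +i b′) = begin
    (x + - y) * (x + - y) + (s + t) * (s + t)
      ≈⟨ solve 4 (λ x ny s t → ((x :+ ny) :* (x :+ ny) :+ (s :+ t) :* (s :+ t)) ⊜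
                               ((x :* x :+ ny :* ny :+ s :* s :+ t :* t) :+ ((x :* ny :+ x :* ny) :+ (s :* t :+ s :* t))))
               ≈-refl x (- y) s t ⟩
    (x * x + - y * - y + s * s + t * t) + ((x * - y + x * - y) + (s * t + s * t))
      ≈⟨ +-cong (+-cong (+-cong (+-cong ≈-refl -y*-y) ≈-refl) ≈-refl) (+-cong (+-cong x*-y x*-y) (+-cong s*t s*t)) ⟩
    (x * x + y * y + s * s + t * t) + ((- (x * y) + - (x * y)) + (x * y + x * y))
      ≈⟨ +-cong ≈-refl (≈-trans (+-cong (-‿+-comm _ _) ≈-refl) (-‿inverseˡ _)) ⟩
    (x * x + y * y + s * s + t * t) + 0#
      ≈⟨ +-identityʳ _ ⟩
    x * x + y * y + s * s + t * t
      ≈⟨ solve 4 (λ a b a′ b′ → ((a :* a′) :* (a :* a′) :+ (b :* b′) :* (b :* b′) :+ (a :* b′) :* (a :* b′) :+ (b :* a′) :* (b :* a′))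
                                ⊜ ((a :* a :+ b :* b) :* (a′ :* a′ :+ b′ :* b′))) ≈-refl a b a′ b′ ⟩
    (a * a + b * b) * (a′ * a′ + b′ * b′) ∎
    where
    open SetoidReasoning setoid
    x = a * a′
    y = b * b′
    s = a * b′
    t = b * a′
    -y*-y : - y * - y ≈ y * y
    -y*-y = ≈-trans (≈-sym (-‿distribˡ-* y (- y))) (≈-trans (-‿cong (≈-sym (-‿distribʳ-* y y))) (-‿involutive _))
    x*-y : x * - y ≈ - (x * y)
    x*-y = ≈-sym (-‿distribʳ-* x y)
    s*t : s * t ≈ x * y
    s*t = solve 4 (λ a b a′ b′ → ((a :* b′) :* (b :* a′)) ⊜ ((a :* a′) :* (b :* b′))) ≈-refl a b a′ b′

-- The matching polynomial

module MatchingPolynomial {c ℓ} (R : CommutativeRing c ℓ) {n : ℕ} (w : Fin n → Fin n → WithRing.Cx R) where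

  open CommutativeRing R renaming (refl to ≈-refl; sym to ≈-sym; trans to ≈-trans)
  open WithRing R
  open Polynomials R
  open RingProperties ring using (-‿distribˡ-*; -0#≈0#)

  Edge : Set
  Edge = Fin n × Fin n

  matchingTerm : ℕ → List Edge → Poly
  matchingTerm m M = (sgn (length M) * normSq (wM w M)) ⊛ xpow (m ∸ 2 ℕ.* length M)

  termIfMatching : ℕ → List Edge → Poly
  termIfMatching m M = ifᵖ (isMatching M) (matchingTerm m M)

  μ-Σsubs : ∀ H → μ w H ≋ Σsubs (edges H) (termIfMatching (length (verts H)))
  μ-Σsubs H = Σ-filter isMatching (subs (edges H)) (matchingTerm (length (verts H)))

  edgeNormSq : Edge → Carrier
  edgeNormSq (i , j) = normSq (w i j)

  normSq-wM : ∀ M → normSq (wM w M) ≈ prodR (map edgeNormSq M)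
  normSq-wM []            = normSq-oneC
  normSq-wM ((i , j) ∷ M) = ≈-trans (normSq-mulC (w i j) (wM w M)) (*-cong ≈-refl (normSq-wM M))

  termIfMatching-↭ : ∀ m → PermInvariant (termIfMatching m)
  termIfMatching-↭ m {M} {M′} p = ifᵖ-cong (isMatching-↭ p) (λ _ → matchingTerm-↭)
    where
    matchingTerm-↭ : matchingTerm m M ≋ matchingTerm m M′
    matchingTerm-↭ k rewrite Permₚ.↭-length p =
      *-cong (*-cong ≈-refl (≈-trans (normSq-wM M) (≈-trans (prodR-map-↭ edgeNormSq p) (≈-sym (normSq-wM M′))))) ≈-refl

  μ-≅ : ∀ {G H : Graph n} → G ≅ H → μ w G ≋ μ w H
  μ-≅ {G} {H} G≅H rewrite verts-≅ G≅H | edges-≅ G≅H = ≋-refl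

  matchingTerm-∷ : ∀ u v m S → matchingTerm (suc (suc m)) ((u , v) ∷ S) ≋ (zeroP ⊖ (normSq (w u v) ⊛ matchingTerm m S))
  matchingTerm-∷ u v m S k = begin
      (- sgn s * normSq (mulC (w u v) (wM w S))) * xpow (suc (suc m) ∸ 2 ℕ.* suc s) k
        ≈⟨ *-cong (*-cong ≈-refl (normSq-mulC _ _)) (reflexive (cong (λ e → xpow e k) exponent)) ⟩
      (- sgn s * (a * N)) * xpow (m ∸ 2 ℕ.* s) k
        ≈⟨ ≈-trans (*-cong (≈-sym (-‿distribˡ-* _ _)) ≈-refl) (≈-sym (-‿distribˡ-* _ _)) ⟩
      - ((sgn s * (a * N)) * xpow (m ∸ 2 ℕ.* s) k)
        ≈⟨ -‿cong (≈-trans (*-cong (*-leftComm (sgn s) a N) ≈-refl) (*-assoc a _ _)) ⟩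
      - (a * ((sgn s * N) * xpow (m ∸ 2 ℕ.* s) k))
        ≈⟨ ≈-sym (+-identityˡ _) ⟩
      0# + - (a * ((sgn s * N) * xpow (m ∸ 2 ℕ.* s) k)) ∎
    where
    open SetoidReasoning setoid
    s = length S
    a = normSq (w u v)
    N = normSq (wM w S)
    exponent : suc (suc m) ∸ 2 ℕ.* suc s ≡ m ∸ 2 ℕ.* s
    exponent = cong (suc (suc m) ∸_) (ℕₚ.*-suc 2 s)

  edges-delV : ∀ (H : Graph n) u → filterᵇ (not ∘ touches u) (edges H) ≡ edges (delV H u)
  edges-delV H u = trans (cong (filterᵇ _) (edges≡filter-allPairs H))
    (trans (filter-filter (isEdge H) _ (allPairs n))
    (trans (filter-cong (allPairs n) avoid-u) (sym (edges≡filter-allPairs (delV H u)))))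
    where
    reorder : ∀ lt vi vj e a b → (lt ∧ vi ∧ vj ∧ e) ∧ not (a ∨ b) ≡ lt ∧ (vi ∧ not a) ∧ (vj ∧ not b) ∧ (e ∧ not a ∧ not b)
    reorder = truth-table 6 _
    avoid-u : ∀ p → (isEdge H p ∧ not (touches u p)) ≡ isEdge (delV H u) p
    avoid-u (i , j) = reorder (ltF i j) (V H i) (V H j) (E H i j) (eqF i u) (eqF j u)

  edges-delVV : ∀ (H : Graph n) u v → filterᵇ (disjointE (u , v)) (edges (delV H u)) ≡ edges (delVV H u v)
  edges-delVV H u v = trans (cong (filterᵇ _) (edges≡filter-allPairs (delV H u)))
    (trans (filter-filter (isEdge (delV H u)) _ (allPairs n))
    (trans (filter-cong (allPairs n) avoid-uv) (sym (edges≡filter-allPairs (delVV H u v)))))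
    where
    reorder : ∀ lt va vb e au bu av bv →
      (lt ∧ (va ∧ not au) ∧ (vb ∧ not bu) ∧ (e ∧ not au ∧ not bu)) ∧ not (au ∨ bu ∨ av ∨ bv)
      ≡ lt ∧ ((va ∧ not au) ∧ not av) ∧ ((vb ∧ not bu) ∧ not bv) ∧ ((e ∧ not au ∧ not bu) ∧ not av ∧ not bv)
    reorder = truth-table 8 _
    avoid-uv : ∀ p → (isEdge (delV H u) p ∧ disjointE (u , v) p) ≡ isEdge (delVV H u v) p
    avoid-uv (a , b) rewrite eqF-sym u a | eqF-sym u b | eqF-sym v a | eqF-sym v b =
      reorder (ltF a b) (V H a) (V H b) (E H a b) (eqF a u) (eqF b u) (eqF a v) (eqF b v)

  termsThrough : ℕ → List Edge → Edge → Poly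
  termsThrough m B a = Σsubs (filterᵇ (disjointE a) B) (λ S → ifᵖ (isMatching S) (matchingTerm m (a ∷ S)))

  -- At most one edge of a matching touches u.
  Σsubs-touching : ∀ (u : Fin n) m (A B : List Edge) → All (λ a → touches u a ≡ true) A →
                   Σsubs (A ++ B) (termIfMatching m) ≋ (Σsubs B (termIfMatching m) ⊕ Σ A (termsThrough m B))
  Σsubs-touching u m [] B _ k = ≈-sym (+-identityʳ _)
  Σsubs-touching u m (a ∷ A) B (ua ∷ uA) =
    ≋-trans (Σsubs-∷ a (A ++ B) (termIfMatching m))
      (≋-trans (⊕-cong (Σsubs-touching u m A B uA) through-a)
               (λ k → ≈-trans (+-assoc _ _ _) (+-cong ≈-refl (+-comm _ _))))
    where
    others-meet-a : filterᵇ (disjointE a) (A ++ B) ≡ filterᵇ (disjointE a) B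
    others-meet-a = trans (Listₚ.filter-++ (T? ∘ disjointE a) A B)
      (cong (_++ _) (filter-false (disjointE a) A (All.map (touches-disjointE u a _ ua) uA)))
    through-a : Σsubs (A ++ B) (termIfMatching m ∘ (a ∷_)) ≋ termsThrough m B a
    through-a = ≋-trans (Σ-cong (subs (A ++ B)) (λ S → ifᵖ-∧ (allB (disjointE a) S) (isMatching S) _))
                (≋-trans (Σsubs-allB (disjointE a) (A ++ B) _) (Σ-≡ _ (cong subs others-meet-a)))

  -- An extra vertex multiplies each term by x; the truncated subtraction in the
  -- exponent is harmless because a matching has at most |V(H)|/2 edges.
  Σsubs-extraVertex : ∀ (H : Graph n) →
    Σsubs (edges H) (termIfMatching (suc (length (verts H)))) ≋ shift (Σsubs (edges H) (termIfMatching (length (verts H))))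
  Σsubs-extraVertex H =
    ≋-trans (Σ-congᴬ (subs (edges H)) (All-subs (edges H) (edges-within H)) term-shift)
            (≋-sym (shift-Σ (subs (edges H)) (termIfMatching m)))
    where
    m = length (verts H)
    term-shift : ∀ S → All (Within (V H)) S → termIfMatching (suc m) S ≋ shift (termIfMatching m S)
    term-shift S within with isMatching S in matching
    ... | false = ≋-sym shift-zeroP
    ... | true  = ≋-sym (≋-trans (shift-⊛ _ (xpow (m ∸ 2 ℕ.* length S)))
                         (⊛-cong ≈-refl (≋-trans (shift-xpow _) (λ k → reflexive (cong (λ e → xpow e k) exponent)))))
      where
      exponent : suc (m ∸ 2 ℕ.* length S) ≡ suc m ∸ 2 ℕ.* length S
      exponent = sym (ℕₚ.+-∸-assoc 1 (matching-size (V H) S within matching))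

  Σ-touching : ∀ (H : Graph n) (u : Fin n) (f : Edge → Poly) →
    Σ (filterᵇ (touches u) (edges H)) f ≋
    Σ (allFin n) (λ v → ifᵖ (isEdge H (u , v)) (f (u , v)) ⊕ ifᵖ (isEdge H (v , u)) (f (v , u)))
  Σ-touching H u f = begin
    Σ (filterᵇ (touches u) (edges H)) f
      ≈⟨ Σ-≡ f (trans (cong (filterᵇ _) (edges≡filter-allPairs H)) (filter-filter (isEdge H) _ (allPairs n))) ⟩
    Σ (filterᵇ (λ p → isEdge H p ∧ touches u p) (allPairs n)) f
      ≈⟨ ≋-trans (Σ-filter _ (allPairs n) f) (Σ-concatMap (λ i → map (i ,_) (allFin n)) (allFin n) _) ⟩
    Σ (allFin n) (λ i → Σ (map (i ,_) (allFin n)) h)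
      ≈⟨ Σ-cong (allFin n) (λ i → ≋-trans (Σ-map (i ,_) (allFin n) h) (Σ-cong (allFin n) (split i))) ⟩
    Σ (allFin n) (λ i → Σ (allFin n) (λ j → first i j ⊕ second i j))
      ≈⟨ ≋-trans (Σ-cong (allFin n) (λ i → Σ-⊕ (allFin n) (first i) (second i)))
                 (Σ-⊕ (allFin n) (λ i → Σ (allFin n) (first i)) (λ i → Σ (allFin n) (second i))) ⟩
    Σ (allFin n) (λ i → Σ (allFin n) (first i)) ⊕ Σ (allFin n) (λ i → Σ (allFin n) (second i))
      ≈⟨ ⊕-cong (≋-trans (Σ-cong (allFin n) (λ i → Σ-ifᵖ (allFin n) (eqF i u) _)) (Σ-allFin-eqF u _))
                (≋-trans (Σ-comm (allFin n) (allFin n) second)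
                         (≋-trans (Σ-cong (allFin n) (λ j → Σ-ifᵖ (allFin n) (eqF j u) _)) (Σ-allFin-eqF u _))) ⟩
    Σ (allFin n) (λ v → ifᵖ (isEdge H (u , v)) (f (u , v))) ⊕ Σ (allFin n) (λ v → ifᵖ (isEdge H (v , u)) (f (v , u)))
      ≈⟨ ≋-sym (Σ-⊕ (allFin n) _ _) ⟩
    Σ (allFin n) (λ v → ifᵖ (isEdge H (u , v)) (f (u , v)) ⊕ ifᵖ (isEdge H (v , u)) (f (v , u))) ∎
    where
    open ≋-Reasoning
    h : Edge → Poly
    h p = ifᵖ (isEdge H p ∧ touches u p) (f p)
    first second : Fin n → Fin n → Poly
    first  i j = ifᵖ (eqF i u) (ifᵖ (isEdge H (u , j)) (f (u , j)))
    second i j = ifᵖ (eqF j u) (ifᵖ (isEdge H (i , u)) (f (i , u)))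
    no-loop : isEdge H (u , u) ≡ false
    no-loop rewrite ltF-irrefl u = refl
    split : ∀ i j → h (i , j) ≋ (first i j ⊕ second i j)
    split i j with eqF i u in iu | eqF j u in ju
    ... | true | true with refl ← eqF⇒≡ {i = i} {u} iu | refl ← eqF⇒≡ {i = j} {u} ju
      rewrite no-loop = λ k → ≈-sym (+-identityˡ 0#)
    split i j | true | false with refl ← eqF⇒≡ {i = i} {u} iu
      rewrite ∧-identityʳ (isEdge H (u , j)) = λ k → ≈-sym (+-identityʳ _)
    split i j | false | true with refl ← eqF⇒≡ {i = j} {u} ju
      rewrite ∧-identityʳ (isEdge H (i , u)) = λ k → ≈-sym (+-identityˡ _)
    split i j | false | false rewrite ∧-zeroʳ (isEdge H (i , j)) = λ k → ≈-sym (+-identityˡ _)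

  termsThrough-uv : ∀ (H : Graph n) u v →
    termsThrough (suc (suc (length (verts (delVV H u v))))) (edges (delV H u)) (u , v)
    ≋ (zeroP ⊖ (normSq (w u v) ⊛ μ w (delVV H u v)))
  termsThrough-uv H u v = begin
    termsThrough (suc (suc m)) (edges (delV H u)) (u , v)
      ≈⟨ Σ-≡ _ (cong subs (edges-delVV H u v)) ⟩
    Σsubs (edges (delVV H u v)) (λ S → ifᵖ (isMatching S) (matchingTerm (suc (suc m)) ((u , v) ∷ S)))
      ≈⟨ Σ-cong (subs (edges (delVV H u v))) term-uv ⟩
    Σsubs (edges (delVV H u v)) (λ S → zeroP ⊖ (a ⊛ termIfMatching m S))
      ≈⟨ ≋-trans (Σ-neg (subs (edges (delVV H u v))) _) (⊖-cong ≋-refl (Σ-⊛ (subs (edges (delVV H u v))) a _)) ⟩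
    zeroP ⊖ (a ⊛ Σsubs (edges (delVV H u v)) (termIfMatching m))
      ≈⟨ ⊖-cong ≋-refl (⊛-cong ≈-refl (≋-sym (μ-Σsubs (delVV H u v)))) ⟩
    zeroP ⊖ (a ⊛ μ w (delVV H u v)) ∎
    where
    open ≋-Reasoning
    m = length (verts (delVV H u v))
    a = normSq (w u v)
    term-uv : ∀ S → ifᵖ (isMatching S) (matchingTerm (suc (suc m)) ((u , v) ∷ S)) ≋ (zeroP ⊖ (a ⊛ termIfMatching m S))
    term-uv S with isMatching S
    ... | true  = matchingTerm-∷ u v m S
    ... | false = λ k → ≈-sym (≈-trans (+-cong ≈-refl (-‿cong (zeroʳ a))) (≈-trans (+-cong ≈-refl -0#≈0#) (+-identityʳ 0#)))

  termsThrough-swap : ∀ (u v : Fin n) m B → normSq (w v u) ≈ normSq (w u v) →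
                      termsThrough m B (v , u) ≋ termsThrough m B (u , v)
  termsThrough-swap u v m B vu≈uv = ≋-trans (Σ-cong (subs (filterᵇ (disjointE (v , u)) B)) term-swap)
                                           (Σ-≡ _ (cong subs (filter-cong B same-ends)))
    where
    swap-pairs : ∀ p q r s → not (p ∨ q ∨ r ∨ s) ≡ not (r ∨ s ∨ p ∨ q)
    swap-pairs = truth-table 4 _
    same-ends : ∀ e → disjointE (v , u) e ≡ disjointE (u , v) e
    same-ends (a , b) = swap-pairs (eqF v a) (eqF v b) (eqF u a) (eqF u b)
    term-swap : ∀ S → ifᵖ (isMatching S) (matchingTerm m ((v , u) ∷ S)) ≋ ifᵖ (isMatching S) (matchingTerm m ((u , v) ∷ S))
    term-swap S with isMatching S
    ... | true  = λ k → *-cong (*-cong ≈-refl (≈-trans (normSq-mulC _ _)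
                          (≈-trans (*-cong vu≈uv ≈-refl) (≈-sym (normSq-mulC _ _))))) ≈-refl
    ... | false = ≋-refl

  μ-empty : ∀ (H : Graph n) → (∀ z → V H z ≡ false) → μ w H ≋ constP 1#
  μ-empty H none rewrite verts-empty H none | edges-empty H none = λ k → ≈-trans (+-identityʳ _)
    (≈-trans (*-cong (≈-trans (*-identityˡ _) normSq-oneC) ≈-refl) (≈-trans (*-identityˡ _) (xpow0 k)))
    where
    xpow0 : ∀ k → xpow 0 k ≈ constP 1# k
    xpow0 zero    = ≈-refl
    xpow0 (suc k) = ≈-refl

  module _ {H : Graph n} (simple : IsSimple H) (weight : EdgeWeight H w) {u : Fin n} (Vu : V H u ≡ true) where

    private
      m = length (verts (delV H u))
      B = edges (delV H u)

    termsThrough-at : ∀ v →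
      (ifᵖ (isEdge H (u , v)) (termsThrough (suc m) B (u , v)) ⊕ ifᵖ (isEdge H (v , u)) (termsThrough (suc m) B (v , u)))
      ≋ ifᵖ (E H u v) (zeroP ⊖ (normSq (w u v) ⊛ μ w (delVV H u v)))
    termsThrough-at v with true-or-false (E H u v)
    ... | inj₂ ¬uv = ≋-trans (⊕-cong (ifᵖ-false (nonEdge⇒¬isEdge H u v ¬uv))
                                     (ifᵖ-false (nonEdge⇒¬isEdge H v u (trans (proj₁ simple v u) ¬uv))))
                             (≋-trans (⊕-identityˡ zeroP) (≋-sym (ifᵖ-false ¬uv)))
    ... | inj₁ uv rewrite count-remove (V (delV H u)) v
                            (cong₂ _∧_ (adjacent⇒vertexʳ simple u v uv) (cong not (adjacent⇒distinct simple u v uv)))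
      with true-or-false (ltF u v)
    ...   | inj₁ u<v = ≋-trans (⊕-cong (ifᵖ-true (edge⇒isEdge simple u v uv u<v))
                                       (ifᵖ-false (¬ordered⇒¬isEdge H v u (ltF-asym {i = u} {v} u<v))))
                               (≋-trans (⊕-identityʳ _) (≋-trans (termsThrough-uv H u v) (≋-sym (ifᵖ-true uv))))
    ...   | inj₂ u≮v = ≋-trans (⊕-cong (ifᵖ-false (¬ordered⇒¬isEdge H u v u≮v))
                                       (ifᵖ-true (edge⇒isEdge simple v u vu v<u)))
                               (≋-trans (⊕-identityˡ _)
                               (≋-trans (termsThrough-swap u v (suc (suc (length (verts (delVV H u v))))) B
                                                           (normSq-cong (proj₁ weight v u vu)))
                               (≋-trans (termsThrough-uv H u v) (≋-sym (ifᵖ-true uv)))))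
      where
      vu : E H v u ≡ true
      vu = trans (proj₁ simple v u) uv
      v<u : ltF v u ≡ true
      v<u = ltF-connex {i = u} {v} (trans (eqF-sym u v) (adjacent⇒distinct simple u v uv)) u≮v

    μ-expand : μ w H ≋ (shift (μ w (delV H u)) ⊖ Σ (filterᵇ (E H u) (allFin n)) (λ v → normSq (w u v) ⊛ μ w (delVV H u v)))
    μ-expand = begin
      μ w H
        ≈⟨ ≋-trans (μ-Σsubs H) (≋-reflexive (cong (λ k → Σsubs (edges H) (termIfMatching k)) (count-remove (V H) u Vu))) ⟩
      Σsubs (edges H) (termIfMatching (suc m))
        ≈⟨ Σsubs-↭ _ (termIfMatching-↭ (suc m)) (filter-partition (touches u) (edges H)) ⟩
      Σsubs (A ++ filterᵇ (not ∘ touches u) (edges H)) (termIfMatching (suc m))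
        ≈⟨ Σ-≡ _ (cong (λ L → subs (A ++ L)) (edges-delV H u)) ⟩
      Σsubs (A ++ B) (termIfMatching (suc m))
        ≈⟨ Σsubs-touching u (suc m) A B (All-filter (touches u) (edges H) (λ _ e → e)) ⟩
      Σsubs B (termIfMatching (suc m)) ⊕ Σ A (termsThrough (suc m) B)
        ≈⟨ ⊕-cong (≋-trans (Σsubs-extraVertex (delV H u)) (shift-cong (≋-sym (μ-Σsubs (delV H u)))))
                  (≋-trans (Σ-touching H u (termsThrough (suc m) B)) (Σ-cong (allFin n) termsThrough-at)) ⟩
      shift (μ w (delV H u)) ⊕ Σ (allFin n) (λ v → ifᵖ (E H u v) (zeroP ⊖ f v))
        ≈⟨ ⊕-cong ≋-refl (≋-trans (≋-sym (Σ-filter (E H u) (allFin n) (λ v → zeroP ⊖ f v))) (Σ-neg (filterᵇ (E H u) (allFin n)) f)) ⟩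
      shift (μ w (delV H u)) ⊕ (zeroP ⊖ Σ (filterᵇ (E H u) (allFin n)) f)
        ≈⟨ (λ k → +-cong ≈-refl (+-identityˡ _)) ⟩
      shift (μ w (delV H u)) ⊖ Σ (filterᵇ (E H u) (allFin n)) f ∎
      where
      open ≋-Reasoning
      A = filterᵇ (touches u) (edges H)
      f : Fin n → Poly
      f v = normSq (w u v) ⊛ μ w (delVV H u v)

-- The polynomial η

module Eta {c ℓ} (R : CommutativeRing c ℓ) {n : ℕ}
           (w : Fin n → Fin n → WithRing.Cx R) (w₁ : Fin n → CommutativeRing.Carrier R) where

  open CommutativeRing R renaming (refl to ≈-refl; sym to ≈-sym; trans to ≈-trans)
  open WithRing R
  open Polynomials R
  open MatchingPolynomial R w
  open NonReflective (fromCommutativeRing R (λ _ → nothing))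
    using (solve; _⊜_) renaming (_⊕_ to _:+_; ⊝_ to :-_)
  open RingProperties ring using (-‿distribˡ-*)

  EdgeWeight-mono : ∀ {G H : Graph n} → (∀ i j → E H i j ≡ true → E G i j ≡ true) → EdgeWeight G w → EdgeWeight H w
  EdgeWeight-mono H⊆G (sym-w , nonzero) = (λ u v e → sym-w u v (H⊆G u v e)) , (λ u v e → nonzero u v (H⊆G u v e))

  EdgeWeight-delV : ∀ (G : Graph n) u → EdgeWeight G w → EdgeWeight (delV G u) w
  EdgeWeight-delV G u = EdgeWeight-mono {G} {delV G u} (λ i j e → ∧-conicalˡ (E G i j) _ e)

  mem : List (Fin n) → Fin n → Bool
  mem S z = elemF z S

  signedWeight : List (Fin n) → Carrier
  signedWeight L = sgn (length L) * prodR (map w₁ L)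

  outside : Graph n → (Fin n → Bool) → List (Fin n)
  outside H P = filterᵇ (not ∘ P) (verts H)

  outside-insert : ∀ G u P → outside G (λ z → eqF z u ∨ P z) ≡ outside (delV G u) P
  outside-insert G u P = trans (filter-filter (V G) _ (allFin n))
    (trans (filter-cong (allFin n) (λ z → outside-law (V G z) (eqF z u) (P z)))
           (sym (filter-filter (λ z → V G z ∧ not (eqF z u)) _ (allFin n))))
    where
    outside-law : ∀ x e p → x ∧ not (e ∨ p) ≡ (x ∧ not e) ∧ not p
    outside-law = truth-table 3 _

  ηTerm : Graph n → Graph n → (Fin n → Bool) → Poly
  ηTerm G H P = signedWeight (outside G P) ⊛ μ w (induced H P)

  ηTerm-cong : ∀ G H {P Q : Fin n → Bool} → (∀ z → P z ≡ Q z) → ηTerm G H P ≋ ηTerm G H Q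
  ηTerm-cong G H P≗Q =
    ⊛-cong (reflexive (cong signedWeight (filter-cong (verts G) (cong not ∘ P≗Q))))
           (μ-≅ ((λ z → cong (V H z ∧_) (P≗Q z)) , (λ i j _ _ → cong₂ (λ a b → E H i j ∧ a ∧ b) (P≗Q i) (P≗Q j))))

  ηTerm-↭ : ∀ H → PermInvariant (ηTerm H H ∘ mem)
  ηTerm-↭ H p = ηTerm-cong H H (λ z → elemF-↭ z p)

  η-≅ : ∀ {G H : Graph n} → G ≅ H → η w w₁ G ≋ η w w₁ H
  η-≅ {G} {H} G≅H = ≋-trans (Σ-≡ _ (cong subs (verts-≅ G≅H)))
    (Σ-cong (subs (verts H)) (λ S → ⊛-cong (reflexive (cong (λ L → signedWeight (filterᵇ (not ∘ mem S) L)) (verts-≅ G≅H)))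
                                          (μ-≅ (induced-≅ (mem S) G≅H))))

  signedWeight-↭ : ∀ {L L′} → L ↭ L′ → signedWeight L ≈ signedWeight L′
  signedWeight-↭ p = *-cong (reflexive (cong sgn (Permₚ.↭-length p))) (prodR-map-↭ w₁ p)

  signedWeight-∷ : ∀ u L → signedWeight (u ∷ L) ≈ - (w₁ u * signedWeight L)
  signedWeight-∷ u L = ≈-trans (≈-sym (-‿distribˡ-* _ _)) (-‿cong (*-leftComm _ _ _))

  module _ (G : Graph n) {u : Fin n} (Vu : V G u ≡ true) where

    -- Subsets of V(G) avoiding u: u joins the complement.
    Σsubs-avoiding : Σsubs (verts (delV G u)) (ηTerm G G ∘ mem) ≋ (zeroP ⊖ (w₁ u ⊛ η w w₁ (delV G u)))
    Σsubs-avoiding =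
      ≋-trans (Σ-congᴬ (subs (verts (delV G u))) (All-subs _ avoid-u) term)
        (≋-trans (Σ-neg (subs (verts (delV G u))) _) (⊖-cong ≋-refl (Σ-⊛ (subs (verts (delV G u))) (w₁ u) _)))
      where
      avoid-u : All (λ y → eqF y u ≡ false) (verts (delV G u))
      avoid-u = All-filter _ (allFin n) (λ y e → not-true⇒false (∧-conicalʳ (V G y) _ e))
      term : ∀ S → All (λ y → eqF y u ≡ false) S → ηTerm G G (mem S) ≋ (zeroP ⊖ (w₁ u ⊛ ηTerm (delV G u) (delV G u) (mem S)))
      term S S∌u k = begin
          signedWeight (outside G P) * μ w (induced G P) k
            ≈⟨ *-cong (≈-trans (signedWeight-↭ outside-↭) (signedWeight-∷ u (outside (delV G u) P))) (μ-≅ same-induced k) ⟩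
          - (w₁ u * signedWeight (outside (delV G u) P)) * μ w (induced (delV G u) P) k
            ≈⟨ ≈-trans (≈-sym (-‿distribˡ-* _ _)) (-‿cong (*-assoc _ _ _)) ⟩
          - (w₁ u * (signedWeight (outside (delV G u) P) * μ w (induced (delV G u) P) k))
            ≈⟨ ≈-sym (+-identityˡ _) ⟩
          0# + - (w₁ u * (signedWeight (outside (delV G u) P) * μ w (induced (delV G u) P) k)) ∎
        where
        open SetoidReasoning setoid
        P = mem S
        u∉S : elemF u S ≡ false
        u∉S = elemF-∉ u S S∌u
        reorder : ∀ v p e → (v ∧ not p) ∧ not e ≡ (v ∧ not e) ∧ not p
        reorder = truth-table 3 _
        outside-↭ : outside G P ↭ u ∷ outside (delV G u) P
        outside-↭ = Perm.trans (↭-reflexive (filter-filter (V G) _ (allFin n)))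
          (Perm.trans (filter-allFin-remove (λ z → V G z ∧ not (P z)) u (cong₂ _∧_ Vu (cong not u∉S)))
            (↭-reflexive (cong (u ∷_) (trans (filter-cong (allFin n) (λ z → reorder (V G z) (P z) (eqF z u)))
              (sym (filter-filter (λ z → V G z ∧ not (eqF z u)) _ (allFin n)))))))
        same-induced : induced G P ≅ induced (delV G u) P
        same-induced = ≅-trans (≅-sym (delV-absent (induced G P) u (trans (cong (V G u ∧_) u∉S) (∧-zeroʳ _))))
                               (delV-induced G P u)

  -- The part of the summand of S ∪ {u} coming from the matchings through uv, without the factor −|w(uv)|².
  termsWith : Graph n → Fin n → Fin n → List (Fin n) → Poly
  termsWith G u v S = ifᵖ (mem S v) (ηTerm (delV G u) (delVV G u v) (mem S))

  module _ {G : Graph n} (simple : IsSimple G) (weight : EdgeWeight G w) {u : Fin n} (Vu : V G u ≡ true) where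

    ηTerm-containing : ∀ S → ηTerm G G (mem (u ∷ S)) ≋
      (shift (ηTerm (delV G u) (delV G u) (mem S)) ⊖ Σ (allFin n) (λ v → ifᵖ (E G u v) (normSq (w u v) ⊛ termsWith G u v S)))
    ηTerm-containing S = begin
      ηTerm G G P₊
        ≈⟨ ⊛-cong (reflexive (cong signedWeight (outside-insert G u P))) (μ-expand (IsSimple-induced simple P₊) weight-S₊ Vu-S₊) ⟩
      σ ⊛ (shift (μ w (delV G[S₊] u)) ⊖ Σ (filterᵇ (E G[S₊] u) (allFin n)) (λ v → normSq (w u v) ⊛ μ w (delVV G[S₊] u v)))
        ≈⟨ ⊛-cong ≈-refl (⊖-cong (shift-cong (μ-≅ drop-u))
                                 (≋-trans (Σ-filter (E G[S₊] u) (allFin n) _) (Σ-cong (allFin n) drop-uv))) ⟩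
      σ ⊛ (shift (μ w (induced (delV G u) P)) ⊖ Σ (allFin n) (λ v → ifᵖ (E G u v ∧ P v) (normSq (w u v) ⊛ μ w (induced (delVV G u v) P))))
        ≈⟨ ≋-trans (⊛-distrib-⊖ σ _ _) (⊖-cong (≋-sym (shift-⊛ σ _)) (≋-sym (Σ-⊛ (allFin n) σ _))) ⟩
      shift (σ ⊛ μ w (induced (delV G u) P)) ⊖ Σ (allFin n) (λ v → σ ⊛ ifᵖ (E G u v ∧ P v) (normSq (w u v) ⊛ μ w (induced (delVV G u v) P)))
        ≈⟨ ⊖-cong ≋-refl (Σ-cong (allFin n) scalar) ⟩
      shift (ηTerm (delV G u) (delV G u) P) ⊖ Σ (allFin n) (λ v → ifᵖ (E G u v) (normSq (w u v) ⊛ termsWith G u v S)) ∎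
      where
      open ≋-Reasoning
      P₊ = mem (u ∷ S)
      P = mem S
      G[S₊] = induced G P₊
      σ = signedWeight (outside (delV G u) P)
      weight-S₊ : EdgeWeight G[S₊] w
      weight-S₊ = EdgeWeight-mono {G} {G[S₊]} (λ i j e → ∧-conicalˡ (E G i j) _ e) weight
      Vu-S₊ : (V G u ∧ (eqF u u ∨ P u)) ≡ true
      Vu-S₊ rewrite Vu | eqF-refl u = refl
      drop-u : delV G[S₊] u ≅ induced (delV G u) P
      drop-u = ≅-trans (delV-induced G P₊ u)
                       (induced-cong (delV G u) (λ z Vz → cong (_∨ P z) (not-true⇒false (∧-conicalʳ (V G z) _ Vz))))
      E-S₊ : ∀ v → E G[S₊] u v ≡ (E G u v ∧ P v)
      E-S₊ v rewrite eqF-refl u with E G u v in e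
      ... | false = refl
      ... | true rewrite adjacent⇒distinct simple u v e = refl
      drop-uv : ∀ v → ifᵖ (E G[S₊] u v) (normSq (w u v) ⊛ μ w (delVV G[S₊] u v)) ≋
                      ifᵖ (E G u v ∧ P v) (normSq (w u v) ⊛ μ w (induced (delVV G u v) P))
      drop-uv v = ifᵖ-cong (E-S₊ v) (λ _ → ⊛-cong ≈-refl (μ-≅ (≅-trans (delV-≅ v drop-u) (delV-induced (delV G u) P v))))
      scalar : ∀ v → (σ ⊛ ifᵖ (E G u v ∧ P v) (normSq (w u v) ⊛ μ w (induced (delVV G u v) P)))
                     ≋ ifᵖ (E G u v) (normSq (w u v) ⊛ termsWith G u v S)
      scalar v with E G u v | P v
      ... | true  | true  = λ k → *-leftComm σ _ _
      ... | true  | false = λ k → ≈-trans (zeroʳ σ) (≈-sym (zeroʳ _))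
      ... | false | _     = λ k → zeroʳ σ

    Σsubs-termsWith : ∀ v → E G u v ≡ true → Σsubs (verts (delV G u)) (termsWith G u v) ≋ η w w₁ (delVV G u v)
    Σsubs-termsWith v uv = begin
      Σsubs (verts (delV G u)) (termsWith G u v)
        ≈⟨ Σsubs-↭ (termsWith G u v) termsWith-↭ (filter-allFin-remove (λ z → V G z ∧ not (eqF z u)) v Vv) ⟩
      Σsubs (v ∷ verts (delVV G u v)) (termsWith G u v)
        ≈⟨ Σsubs-∷ v (verts (delVV G u v)) (termsWith G u v) ⟩
      Σsubs (verts (delVV G u v)) (termsWith G u v) ⊕ Σsubs (verts (delVV G u v)) (termsWith G u v ∘ (v ∷_))
        ≈⟨ ⊕-cong without-v (Σ-cong (subs (verts (delVV G u v))) with-v) ⟩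
      zeroP ⊕ η w w₁ (delVV G u v)
        ≈⟨ ⊕-identityˡ _ ⟩
      η w w₁ (delVV G u v) ∎
      where
      open ≋-Reasoning
      Vv : (V G v ∧ not (eqF v u)) ≡ true
      Vv = cong₂ _∧_ (adjacent⇒vertexʳ simple u v uv) (cong not (adjacent⇒distinct simple u v uv))
      termsWith-↭ : PermInvariant (termsWith G u v)
      termsWith-↭ p = ifᵖ-cong (elemF-↭ v p) (λ _ → ηTerm-cong (delV G u) (delVV G u v) (λ z → elemF-↭ z p))
      avoid-v : All (λ y → eqF y v ≡ false) (verts (delVV G u v))
      avoid-v = All-filter _ (allFin n) (λ y e → not-true⇒false (∧-conicalʳ (V G y ∧ not (eqF y u)) _ e))
      without-v : Σsubs (verts (delVV G u v)) (termsWith G u v) ≋ zeroP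
      without-v = ≋-trans (Σ-congᴬ (subs (verts (delVV G u v))) (All-subs _ avoid-v) (λ S S∌v → ifᵖ-false (elemF-∉ v S S∌v)))
                          (Σ-zero (subs (verts (delVV G u v))))
      with-v : ∀ S → termsWith G u v (v ∷ S) ≋ ηTerm (delVV G u v) (delVV G u v) (mem S)
      with-v S rewrite eqF-refl v = ⊛-cong
        (reflexive (cong signedWeight (outside-insert (delV G u) v (mem S))))
        (μ-≅ (induced-cong (delVV G u v) (λ z Vz → cong (_∨ elemF z S) (not-true⇒false (∧-conicalʳ _ _ Vz)))))

    Σsubs-containing : Σsubs (verts (delV G u)) (ηTerm G G ∘ mem ∘ (u ∷_)) ≋
      (shift (η w w₁ (delV G u)) ⊖ Σ (allFin n) (λ v → ifᵖ (E G u v) (normSq (w u v) ⊛ η w w₁ (delVV G u v))))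
    Σsubs-containing =
      ≋-trans (Σ-cong (subs V′) ηTerm-containing)
      (≋-trans (Σ-⊖ (subs V′) _ _)
      (⊖-cong (≋-sym (shift-Σ (subs V′) (ηTerm (delV G u) (delV G u) ∘ mem)))
              (≋-trans (Σ-comm (subs V′) (allFin n) _) (Σ-cong (allFin n) neighbour))))
      where
      V′ = verts (delV G u)
      neighbour : ∀ v → Σsubs V′ (λ S → ifᵖ (E G u v) (normSq (w u v) ⊛ termsWith G u v S)) ≋
                        ifᵖ (E G u v) (normSq (w u v) ⊛ η w w₁ (delVV G u v))
      neighbour v = ≋-trans (Σ-ifᵖ (subs V′) (E G u v) _) (ifᵖ-cong refl (λ uv →
                      ≋-trans (Σ-⊛ (subs V′) (normSq (w u v)) (termsWith G u v)) (⊛-cong ≈-refl (Σsubs-termsWith v uv))))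

    η-expand : η w w₁ G ≋ ((shift (η w w₁ (delV G u)) ⊖ (w₁ u ⊛ η w w₁ (delV G u)))
                           ⊖ Σ (filterᵇ (E G u) (allFin n)) (λ v → normSq (w u v) ⊛ η w w₁ (delVV G u v)))
    η-expand = begin
      η w w₁ G
        ≈⟨ Σsubs-↭ (ηTerm G G ∘ mem) (ηTerm-↭ G) (filter-allFin-remove (V G) u Vu) ⟩
      Σsubs (u ∷ verts (delV G u)) (ηTerm G G ∘ mem)
        ≈⟨ ≋-trans (Σsubs-∷ u (verts (delV G u)) _) (⊕-cong (Σsubs-avoiding G Vu) Σsubs-containing) ⟩
      (zeroP ⊖ (w₁ u ⊛ η′)) ⊕ (shift η′ ⊖ Σ (allFin n) (λ v → ifᵖ (E G u v) (f v)))
        ≈⟨ ⊕-cong ≋-refl (⊖-cong ≋-refl (≋-sym (Σ-filter (E G u) (allFin n) f))) ⟩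
      (zeroP ⊖ (w₁ u ⊛ η′)) ⊕ (shift η′ ⊖ Σ (filterᵇ (E G u) (allFin n)) f)
        ≈⟨ (λ k → ≈-trans (+-cong (+-identityˡ _) ≈-refl)
                    (solve 3 (λ a s t → ((:- a) :+ (s :+ (:- t))) ⊜ ((s :+ (:- a)) :+ (:- t))) ≈-refl _ _ _)) ⟩
      (shift η′ ⊖ (w₁ u ⊛ η′)) ⊖ Σ (filterᵇ (E G u) (allFin n)) f ∎
      where
      open ≋-Reasoning
      η′ = η w w₁ (delV G u)
      f : Fin n → Poly
      f v = normSq (w u v) ⊛ η w w₁ (delVV G u v)

    η-expand-⊗ : ∀ q → (η w w₁ G ⊗ q) ≋
      ((shift (η w w₁ (delV G u) ⊗ q) ⊖ (w₁ u ⊛ (η w w₁ (delV G u) ⊗ q)))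
       ⊖ Σ (filterᵇ (E G u) (allFin n)) (λ v → normSq (w u v) ⊛ (η w w₁ (delVV G u v) ⊗ q)))
    η-expand-⊗ q = ≋-trans (⊗-congˡ q η-expand) (≋-trans (⊗-distribʳ-⊖ _ _ q)
      (⊖-cong (≋-trans (⊗-distribʳ-⊖ _ _ q) (⊖-cong (⊗-shiftˡ _ q) (⊗-⊛ˡ (w₁ u) _ q)))
              (≋-trans (⊗-Σˡ N _ q) (Σ-cong N (λ v → ⊗-⊛ˡ (normSq (w u v)) _ q)))))
      where
      N = filterᵇ (E G u) (allFin n)

  η-empty : ∀ (G : Graph n) → (∀ z → V G z ≡ false) → η w w₁ G ≋ constP 1#
  η-empty G none rewrite verts-empty G none =
    λ k → ≈-trans (+-identityʳ _)
      (≈-trans (*-cong (*-identityˡ 1#) (μ-empty (induced G (mem [])) (λ z → cong (_∧ false) (none z)) k)) (*-identityˡ _))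

  η-delE : ∀ {G : Graph n} → IsSimple G → EdgeWeight G w → ∀ u v → E G u v ≡ true →
           η w w₁ G ≋ (η w w₁ (delE G u v) ⊖ (normSq (w u v) ⊛ η w w₁ (delVV G u v)))
  η-delE {G} simple weight u v uv = begin
    η w w₁ G
      ≈⟨ η-expand simple weight Vu ⟩
    (shift η′ ⊖ (w₁ u ⊛ η′)) ⊖ Σ (filterᵇ (E G u) (allFin n)) f
      ≈⟨ ⊖-cong ≋-refl (Σ-↭ f (filter-allFin-remove (E G u) v uv)) ⟩
    (shift η′ ⊖ (w₁ u ⊛ η′)) ⊖ (f v ⊕ Σ N′ f)
      ≈⟨ (λ k → solve 3 (λ a b c → (a :+ (:- (b :+ c))) ⊜ ((a :+ (:- c)) :+ (:- b))) ≈-refl _ _ _) ⟩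
    ((shift η′ ⊖ (w₁ u ⊛ η′)) ⊖ Σ N′ f) ⊖ f v
      ≈⟨ ⊖-cong (≋-sym η-G′) ≋-refl ⟩
    η w w₁ (delE G u v) ⊖ f v ∎
    where
    open ≋-Reasoning
    Vu = adjacent⇒vertexˡ simple u v uv
    G′ = delE G u v
    η′ = η w w₁ (delV G u)
    N′ = filterᵇ (λ x → E G u x ∧ not (eqF x v)) (allFin n)
    f : Fin n → Poly
    f x = normSq (w u x) ⊛ η w w₁ (delVV G u x)
    removed-law : ∀ x a b c d → (x ∧ not ((a ∧ b) ∨ (c ∧ d))) ∧ not a ∧ not d ≡ x ∧ not a ∧ not d
    removed-law = truth-table 5 _
    same-delV : delV G′ u ≅ delV G u
    same-delV = (λ z → refl) , (λ i j _ _ → removed-law (E G i j) (eqF i u) (eqF j v) (eqF i v) (eqF j u))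
    u≢v : eqF u v ≡ false
    u≢v = trans (eqF-sym u v) (adjacent⇒distinct simple u v uv)
    same-neighbours : filterᵇ (E G′ u) (allFin n) ≡ N′
    same-neighbours = filter-cong (allFin n) neighbour
      where
      ∨-false : ∀ e a → e ∧ not (a ∨ false) ≡ e ∧ not a
      ∨-false = truth-table 2 _
      neighbour : ∀ x → E G′ u x ≡ (E G u x ∧ not (eqF x v))
      neighbour x rewrite eqF-refl u | u≢v = ∨-false (E G u x) (eqF x v)
    η-G′ : η w w₁ G′ ≋ ((shift η′ ⊖ (w₁ u ⊛ η′)) ⊖ Σ N′ f)
    η-G′ = ≋-trans (η-expand (IsSimple-delE simple u v) (EdgeWeight-mono {G} {G′} (λ i j e → ∧-conicalˡ (E G i j) _ e) weight) Vu)
      (⊖-cong (⊖-cong (shift-cong (η-≅ same-delV)) (⊛-cong ≈-refl (η-≅ same-delV)))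
              (≋-trans (Σ-≡ _ same-neighbours)
                       (Σ-cong N′ (λ x → ⊛-cong ≈-refl (η-≅ (delV-≅ x same-delV))))))

  module _ {G₂ : Graph n} (simple₂ : IsSimple G₂) (weight₂ : EdgeWeight G₂ w) where

    private
      η₂ = η w w₁ G₂

      EdgeWeight-union : ∀ {G₁ : Graph n} → EdgeWeight G₁ w → EdgeWeight (union G₁ G₂) w
      EdgeWeight-union {G₁} (sym₁ , nonzero₁) = either sym₁ (proj₁ weight₂) , either nonzero₁ (proj₂ weight₂)
        where
        either : ∀ {p} {P : Fin n → Fin n → Set p} → (∀ u v → E G₁ u v ≡ true → P u v) → (∀ u v → E G₂ u v ≡ true → P u v) →
                 ∀ u v → (E G₁ u v ∨ E G₂ u v) ≡ true → P u v
        either on₁ on₂ u v e with E G₁ u v in e₁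
        ... | true  = on₁ u v e₁
        ... | false = on₂ u v e

    η-union : ∀ (G₁ : Graph n) → IsSimple G₁ → EdgeWeight G₁ w → Disjoint G₁ G₂ →
              η w w₁ (union G₁ G₂) ≋ (η w w₁ G₁ ⊗ η₂)
    η-union = vertex-induction _ empty step
      where
      empty : ∀ G₁ → (∀ z → V G₁ z ≡ false) → IsSimple G₁ → EdgeWeight G₁ w → Disjoint G₁ G₂ →
              η w w₁ (union G₁ G₂) ≋ (η w w₁ G₁ ⊗ η₂)
      empty G₁ none simple₁ _ _ = begin
        η w w₁ (union G₁ G₂)       ≈⟨ η-≅ just-G₂ ⟩
        η₂                         ≈⟨ ≋-sym (≋-trans (⊗-constˡ 1# η₂) (λ k → *-identityˡ _)) ⟩
        constP 1# ⊗ η₂             ≈⟨ ⊗-congˡ η₂ (≋-sym (η-empty G₁ none)) ⟩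
        η w w₁ G₁ ⊗ η₂             ∎
        where
        open ≋-Reasoning
        no-edge : ∀ i j → E G₁ i j ≡ false
        no-edge i j with E G₁ i j in e
        ... | false = refl
        ... | true  = ⊥-elim (true≢false (trans (sym (adjacent⇒vertexˡ simple₁ i j e)) (none i)))
        just-G₂ : union G₁ G₂ ≅ G₂
        just-G₂ = (λ z → cong (_∨ V G₂ z) (none z)) , (λ i j _ _ → cong (_∨ E G₂ i j) (no-edge i j))
      step : ∀ G₁ u → V G₁ u ≡ true →
             (∀ H → length (verts H) < length (verts G₁) → IsSimple H → EdgeWeight H w → Disjoint H G₂ →
                    η w w₁ (union H G₂) ≋ (η w w₁ H ⊗ η₂)) →
             IsSimple G₁ → EdgeWeight G₁ w → Disjoint G₁ G₂ → η w w₁ (union G₁ G₂) ≋ (η w w₁ G₁ ⊗ η₂)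
      step G₁ u Vu ih simple₁ weight₁ disjoint = begin
        η w w₁ U
          ≈⟨ η-expand (IsSimple-union {G = G₁} {G₂} simple₁ simple₂) (EdgeWeight-union {G₁} weight₁) (cong (_∨ V G₂ u) Vu) ⟩
        (shift (η w w₁ (delV U u)) ⊖ (w₁ u ⊛ η w w₁ (delV U u))) ⊖ Σ (filterᵇ (E U u) (allFin n)) fU
          ≈⟨ ⊖-cong (⊖-cong (shift-cong ih-u) (⊛-cong ≈-refl ih-u))
                    (≋-trans (Σ-≡ fU (filter-cong {p = E U u} (allFin n) same-neighbours))
                             (Σ-congᴬ N₁ (All-filter (E G₁ u) (allFin n) (λ _ e → e)) ih-uv)) ⟩
        (shift (η₁′ ⊗ η₂) ⊖ (w₁ u ⊛ (η₁′ ⊗ η₂))) ⊖ Σ N₁ (λ v → normSq (w u v) ⊛ (η w w₁ (delVV G₁ u v) ⊗ η₂))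
          ≈⟨ ≋-sym (η-expand-⊗ simple₁ weight₁ Vu η₂) ⟩
        η w w₁ G₁ ⊗ η₂ ∎
        where
        open ≋-Reasoning
        U = union G₁ G₂
        η₁′ = η w w₁ (delV G₁ u)
        N₁ = filterᵇ (E G₁ u) (allFin n)
        fU : Fin n → Poly
        fU v = normSq (w u v) ⊛ η w w₁ (delVV U u v)
        outside₂ : ∀ {z} → V G₁ z ≡ true → V G₂ z ≡ false
        outside₂ {z} V₁z = trans (sym (cong (_∧ V G₂ z) V₁z)) (disjoint z)
        ih-u : η w w₁ (delV U u) ≋ (η₁′ ⊗ η₂)
        ih-u = ≋-trans (η-≅ (delV-union G₁ G₂ simple₂ u (outside₂ Vu)))
                       (ih (delV G₁ u) (verts-delV-< G₁ Vu) (IsSimple-delV simple₁ u) (EdgeWeight-delV G₁ u weight₁) (Disjoint-delV G₁ {G₂} u disjoint))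
        same-neighbours : ∀ v → E U u v ≡ E G₁ u v
        same-neighbours v with E G₂ u v in e
        ... | false = ∨-identityʳ (E G₁ u v)
        ... | true  = ⊥-elim (true≢false (trans (sym (adjacent⇒vertexˡ simple₂ u v e)) (outside₂ Vu)))
        ih-uv : ∀ v → E G₁ u v ≡ true → fU v ≋ (normSq (w u v) ⊛ (η w w₁ (delVV G₁ u v) ⊗ η₂))
        ih-uv v uv = ⊛-cong ≈-refl (≋-trans (η-≅ split) (ih (delVV G₁ u v) shorter (IsSimple-delV (IsSimple-delV simple₁ u) v)
                       (EdgeWeight-delV (delV G₁ u) v (EdgeWeight-delV G₁ u weight₁)) (Disjoint-delV (delV G₁ u) {G₂} v (Disjoint-delV G₁ {G₂} u disjoint))))
          where
          split : delVV U u v ≅ union (delVV G₁ u v) G₂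
          split = ≅-trans (delV-≅ v (delV-union G₁ G₂ simple₂ u (outside₂ Vu)))
                          (delV-union (delV G₁ u) G₂ simple₂ v (outside₂ (adjacent⇒vertexʳ simple₁ u v uv)))
          shorter : length (verts (delVV G₁ u v)) < length (verts G₁)
          shorter = ℕₚ.≤-trans (s≤s (verts-delV-≤ (delV G₁ u) v)) (verts-delV-< G₁ Vu)

  ηDeletions : Graph n → Poly
  ηDeletions H = Σ (verts H) (λ z → η w w₁ (delV H z))

  -- Both sides sum over the pairs (z , v) with v a neighbour of u and z ∉ {u , v}.
  Σ-neighbourDeletions : ∀ (G : Graph n) u →
    Σ (verts (delV G u)) (λ z → Σ (filterᵇ (E (delV G z) u) (allFin n)) (λ v → normSq (w u v) ⊛ η w w₁ (delVV (delV G z) u v)))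
    ≋ Σ (filterᵇ (E G u) (allFin n)) (λ v → normSq (w u v) ⊛ ηDeletions (delVV G u v))
  Σ-neighbourDeletions G u = begin
    Σ (filterᵇ (λ z → V G z ∧ not (eqF z u)) (allFin n)) (λ z → Σ (filterᵇ (E (delV G z) u) (allFin n)) (f z))
      ≈⟨ Σ-filter² (λ z → V G z ∧ not (eqF z u)) (λ z v → E (delV G z) u v) (allFin n) (allFin n) f ⟩
    Σ (allFin n) (λ z → Σ (allFin n) (λ v → ifᵖ ((V G z ∧ not (eqF z u)) ∧ E (delV G z) u v) (f z v)))
      ≈⟨ ≋-trans (Σ-comm (allFin n) (allFin n) _) (Σ-cong (allFin n) (λ v → Σ-cong (allFin n) (λ z → same-pair z v))) ⟩
    Σ (allFin n) (λ v → Σ (allFin n) (λ z → ifᵖ (E G u v ∧ V (delVV G u v) z) (normSq (w u v) ⊛ η w w₁ (delV (delVV G u v) z))))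
      ≈⟨ ≋-sym (Σ-filter² (E G u) (λ v z → V (delVV G u v) z) (allFin n) (allFin n) _) ⟩
    Σ (filterᵇ (E G u) (allFin n)) (λ v → Σ (verts (delVV G u v)) (λ z → normSq (w u v) ⊛ η w w₁ (delV (delVV G u v) z)))
      ≈⟨ Σ-cong (filterᵇ (E G u) (allFin n)) (λ v → Σ-⊛ (verts (delVV G u v)) (normSq (w u v)) _) ⟩
    Σ (filterᵇ (E G u) (allFin n)) (λ v → normSq (w u v) ⊛ ηDeletions (delVV G u v)) ∎
    where
    open ≋-Reasoning
    f : Fin n → Fin n → Poly
    f z v = normSq (w u v) ⊛ η w w₁ (delVV (delV G z) u v)
    pair-law : ∀ x a e b → (x ∧ not a) ∧ (e ∧ not a ∧ not b) ≡ e ∧ ((x ∧ not a) ∧ not b)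
    pair-law = truth-table 4 _
    same-pair : ∀ z v → ifᵖ ((V G z ∧ not (eqF z u)) ∧ E (delV G z) u v) (f z v) ≋
                        ifᵖ (E G u v ∧ V (delVV G u v) z) (normSq (w u v) ⊛ η w w₁ (delV (delVV G u v) z))
    same-pair z v = ifᵖ-cong condition (λ _ → ⊛-cong ≈-refl (η-≅ (≅-trans (delV-≅ v (delV-comm G z u)) (delV-comm (delV G u) z v))))
      where
      condition : ((V G z ∧ not (eqF z u)) ∧ (E G u v ∧ not (eqF u z) ∧ not (eqF v z))) ≡ (E G u v ∧ ((V G z ∧ not (eqF z u)) ∧ not (eqF z v)))
      condition rewrite eqF-sym u z | eqF-sym v z = pair-law (V G z) (eqF z u) (E G u v) (eqF z v)

  module _ {G : Graph n} (simple : IsSimple G) (weight : EdgeWeight G w) {u : Fin n} (Vu : V G u ≡ true) where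

    Σ-expand-others : Σ (verts (delV G u)) (λ z → η w w₁ (delV G z)) ≋
      ((shift (ηDeletions (delV G u)) ⊖ (w₁ u ⊛ ηDeletions (delV G u)))
       ⊖ Σ (filterᵇ (E G u) (allFin n)) (λ v → normSq (w u v) ⊛ ηDeletions (delVV G u v)))
    Σ-expand-others = begin
      Σ V′ (λ z → η w w₁ (delV G z))
        ≈⟨ Σ-congᴬ V′ (All-filter _ (allFin n) (λ _ e → e)) expand-z ⟩
      Σ V′ (λ z → (shift (ηzu z) ⊖ (w₁ u ⊛ ηzu z)) ⊖ Σ (filterᵇ (E (delV G z) u) (allFin n)) (f z))
        ≈⟨ ≋-trans (Σ-⊖ V′ _ _) (⊖-cong (Σ-⊖ V′ _ _) ≋-refl) ⟩
      (Σ V′ (shift ∘ ηzu) ⊖ Σ V′ (λ z → w₁ u ⊛ ηzu z)) ⊖ Σ V′ (λ z → Σ (filterᵇ (E (delV G z) u) (allFin n)) (f z))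
        ≈⟨ ⊖-cong (⊖-cong (≋-trans (≋-sym (shift-Σ V′ ηzu)) (shift-cong (Σ-cong V′ swap-uz)))
                          (≋-trans (Σ-⊛ V′ (w₁ u) ηzu) (⊛-cong ≈-refl (Σ-cong V′ swap-uz))))
                  (Σ-neighbourDeletions G u) ⟩
      (shift (ηDeletions (delV G u)) ⊖ (w₁ u ⊛ ηDeletions (delV G u)))
        ⊖ Σ (filterᵇ (E G u) (allFin n)) (λ v → normSq (w u v) ⊛ ηDeletions (delVV G u v)) ∎
      where
      open ≋-Reasoning
      V′ = verts (delV G u)
      ηzu : Fin n → Poly
      ηzu z = η w w₁ (delV (delV G z) u)
      f : Fin n → Fin n → Poly
      f z v = normSq (w u v) ⊛ η w w₁ (delVV (delV G z) u v)
      expand-z : ∀ z → (V G z ∧ not (eqF z u)) ≡ true →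
        η w w₁ (delV G z) ≋ ((shift (ηzu z) ⊖ (w₁ u ⊛ ηzu z)) ⊖ Σ (filterᵇ (E (delV G z) u) (allFin n)) (f z))
      expand-z z Vz = η-expand (IsSimple-delV simple z) (EdgeWeight-delV G z weight)
        (cong₂ _∧_ Vu (cong not (trans (eqF-sym u z) (not-true⇒false (∧-conicalʳ (V G z) _ Vz)))))
      swap-uz : ∀ z → ηzu z ≋ η w w₁ (delV (delV G u) z)
      swap-uz z = η-≅ (delV-comm G z u)

  η-derivative : ∀ (G : Graph n) → IsSimple G → EdgeWeight G w → D (η w w₁ G) ≋ ηDeletions G
  η-derivative = vertex-induction _ empty step
    where
    empty : ∀ G → (∀ z → V G z ≡ false) → IsSimple G → EdgeWeight G w → D (η w w₁ G) ≋ ηDeletions G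
    empty G none _ _ = ≋-trans (D-cong (η-empty G none))
                      (≋-trans (D-const 1#) (≋-sym (Σ-≡ (λ v → η w w₁ (delV G v)) (verts-empty G none))))
    step : ∀ G u → V G u ≡ true →
           (∀ H → length (verts H) < length (verts G) → IsSimple H → EdgeWeight H w → D (η w w₁ H) ≋ ηDeletions H) →
           IsSimple G → EdgeWeight G w → D (η w w₁ G) ≋ ηDeletions G
    step G u Vu ih simple weight = begin
      D (η w w₁ G)
        ≈⟨ D-cong (η-expand simple weight Vu) ⟩
      D ((shift η′ ⊖ (w₁ u ⊛ η′)) ⊖ Σ N f)
        ≈⟨ ≋-trans (D-⊖ (shift η′ ⊖ (w₁ u ⊛ η′)) (Σ N f))
                   (⊖-cong (≋-trans (D-⊖ (shift η′) (w₁ u ⊛ η′))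
                                    (⊖-cong (≋-trans (D-shift η′) (⊕-cong ≋-refl (shift-cong ih-u)))
                                            (≋-trans (D-⊛ (w₁ u) η′) (⊛-cong ≈-refl ih-u))))
                           (≋-trans (D-Σ N f) (Σ-cong N (λ v → ≋-trans (D-⊛ (normSq (w u v)) (η w w₁ (delVV G u v)))
                                                                        (⊛-cong ≈-refl (ih-uv v)))))) ⟩
      ((η′ ⊕ shift S) ⊖ (w₁ u ⊛ S)) ⊖ Σ N g
        ≈⟨ (λ k → solve 4 (λ a s x y → (((a :+ s) :+ (:- x)) :+ (:- y)) ⊜ (a :+ ((s :+ (:- x)) :+ (:- y)))) ≈-refl _ _ _ _) ⟩
      η′ ⊕ ((shift S ⊖ (w₁ u ⊛ S)) ⊖ Σ N g)
        ≈⟨ ⊕-cong ≋-refl (≋-sym (Σ-expand-others simple weight Vu)) ⟩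
      η′ ⊕ Σ (verts (delV G u)) (λ z → η w w₁ (delV G z))
        ≈⟨ ≋-sym (Σ-↭ (λ v → η w w₁ (delV G v)) (filter-allFin-remove (V G) u Vu)) ⟩
      ηDeletions G ∎
      where
      open ≋-Reasoning
      N = filterᵇ (E G u) (allFin n)
      η′ = η w w₁ (delV G u)
      S = ηDeletions (delV G u)
      f g : Fin n → Poly
      f v = normSq (w u v) ⊛ η w w₁ (delVV G u v)
      g v = normSq (w u v) ⊛ ηDeletions (delVV G u v)
      ih-u : D η′ ≋ S
      ih-u = ih (delV G u) (verts-delV-< G Vu) (IsSimple-delV simple u) (EdgeWeight-delV G u weight)
      ih-uv : ∀ v → D (η w w₁ (delVV G u v)) ≋ ηDeletions (delVV G u v)
      ih-uv v = ih (delVV G u v) (ℕₚ.≤-trans (s≤s (verts-delV-≤ (delV G u) v)) (verts-delV-< G Vu))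
                   (IsSimple-delV (IsSimple-delV simple u) v) (EdgeWeight-delV (delV G u) v (EdgeWeight-delV G u weight))

theorem2p2 : ∀ {c ℓ} (R : CommutativeRing c ℓ) → let open WithRing R in
  (n : ℕ) (w : Fin n → Fin n → Cx) (w₁ : Fin n → CommutativeRing.Carrier R) →
  -- (a) disjoint union
  ((G₁ G₂ : Graph n) → IsSimple G₁ → IsSimple G₂ →
     EdgeWeight G₁ w → EdgeWeight G₂ w →
     (∀ z → (V G₁ z ∧ V G₂ z) ≡ false) →
     η w w₁ (union G₁ G₂) ≋ (η w w₁ G₁ ⊗ η w w₁ G₂))
  ×
  -- (b) edge deletion
  ((G : Graph n) → IsSimple G → EdgeWeight G w → (u v : Fin n) → E G u v ≡ true →
     η w w₁ G ≋ (η w w₁ (delE G u v) ⊖ (normSq (w u v) ⊛ η w w₁ (delVV G u v))))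
  ×
  -- (c) vertex expansion
  ((G : Graph n) → IsSimple G → EdgeWeight G w → (u : Fin n) → V G u ≡ true →
     η w w₁ G ≋ (((X ⊖ constP (w₁ u)) ⊗ η w w₁ (delV G u))
                 ⊖ polySum (map (λ v → normSq (w u v) ⊛ η w w₁ (delVV G u v))
                                (filterᵇ (E G u) (allFin n)))))
  ×
  -- (d) derivative
  ((G : Graph n) → IsSimple G → EdgeWeight G w →
     D (η w w₁ G) ≋ polySum (map (λ v → η w w₁ (delV G v)) (verts G)))
theorem2p2 R n w w₁ =
  (λ G₁ G₂ simple₁ simple₂ weight₁ weight₂ → η-union simple₂ weight₂ G₁ simple₁ weight₁) ,
  (λ G simple weight → η-delE simple weight) ,
  (λ G simple weight u Vu → ≋-trans (η-expand simple weight Vu)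
                                    (⊖-cong (≋-sym (⊗-X-constˡ (w₁ u) (η w w₁ (delV G u)))) ≋-refl)) ,
  η-derivative
  where
  open WithRing R
  open Polynomials R
  open Eta R w w₁
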